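{- In the setting described in the context, let $X=\sum_{i=0}^{\mathfrak m}X_iN^i\in M_r(\mathbb C_\infty)[N]$, where each $X_i$ is a skew $k$-block matrix whose $(\alpha,\beta)$-block equals the $(\alpha,\beta)$-block of $\bar C_i$ for all $(\alpha,\beta)$ outside the set $\{i\le\mathfrak m-1,\ \alpha\le\mathfrak m-i,\ \beta\le i+1\}$, the blocks in that set being arbitrary. If $B(S)^t\cdot X\in N^{\mathfrak m}M_r(\mathbb C_\infty[N])$, then $X=\bar B(S)$.
   Context: Let $\mathbb C_\infty$ be the completion of an algebraic closure of $\mathbb F_q((1/\theta))$. Let $V$ be a finite-dimensional $\mathbb C_\infty$-vector space, $N$ a nilpotent operator on $V$, $\mathfrak m\ge1$ with $N^{\mathfrak m}=0$. Let $k_1,\dots,k_{\mathfrak m+1}\ge0$ be integers with sum $r$, and $l_{u,i}\in V$ ($1\le u\le\mathfrak m+1$, $1\le i\le k_u$) such that for every $u_0\in\{0,\dots,\mathfrak m-1\}$ the elements $N^\alpha l_{\beta,\gamma}$, $\alpha\in\{u_0,\dots,\mathfrak m-1\}$, $\beta\in\{\alpha+2,\dots,\mathfrak m+1\}$, $\gamma\in\{1,\dots,k_\beta\}$, form a $\mathbb C_\infty$-basis of $N^{u_0}V$. With $\hat l_u=(l_{u,1},\dots,l_{u,k_u})^t$: for $u\in\{1,\dots,\mathfrak m\}$, $z\in\{u-1,\dots,\mathfrak m-1\}$, $y\in\{z+2,\dots,\mathfrak m+1\}$, $S_{u,u-1,y,z}$ are the unique $k_u\times k_y$ matrices with $N^{u-1}\hat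 l_u=-\sum_{z=u-1}^{\mathfrak m-1}\sum_{y=z+2}^{\mathfrak m+1}S_{u,u-1,y,z}N^z\hat l_y$; for $v\in\{0,\dots,\mathfrak m-1\}$, $u\in\{1,\dots,\mathfrak m+1\}$, $z\in\{v,\dots,\mathfrak m-1\}$, $y\in\{z+2,\dots,\mathfrak m+1\}$, $P_{u,v,y,z}$ are the unique $k_u\times k_y$ matrices with $N^v\hat l_u=-\sum_{z=v}^{\mathfrak m-1}\sum_{y=z+2}^{\mathfrak m+1}P_{u,v,y,z}N^z\hat l_y$. A skew $k$-block matrix is an $r\times r$ matrix divided into $(\mathfrak m+1)\times(\mathfrak m+1)$ blocks, the $(\alpha,\beta)$-block of size $k_\alpha\times k_{\mathfrak m+2-\beta}$. For $i=0,\dots,\mathfrak m$: $C_i$ has $(\alpha,\beta)$-block $S^t_{\mathfrak m+2-\beta,\mathfrak m+1-\beta,\alpha,i}$ whenever defined ($\mathfrak m+2-\beta\le\mathfrak m$, $\mathfrak m+1-\beta\le i\le\mathfrak m-1$, $\alpha\ge i+2$), $(i+1,\mathfrak m+1-i)$-block $I_{k_{i+1}}$, other blocks $0$; $\bar C_i$ has $(\alpha,\beta)$-block $-P_{\alpha,\mathfrak m-1-i,\mathfrak m+2-\beta,\mathfrak m-\beta}$ whenever $i\le\mathfrak m-1$, $\alpha\le\mathfrak m-i$, $\beta\le i+1$, $(\mathfrak m+1-i,i+1)$-block $I_{k_{\mathfrak m+1-i}}$, other blocks $0$. $B(S)=\sum_{i=0}^{\mathfrak m}C_iN^i$, $B(S)^t=\sum_i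 C_i^tN^i$, $\bar B(S)=\sum_{i=0}^{\mathfrak m}\bar C_iN^i$ in $M_r(\mathbb C_\infty)[N]$, $N$ a formal variable. -}

module Defs where

open import Level using (Level; _⊔_) renaming (suc to lsuc)
open import Data.Nat as ℕ using (ℕ; zero; suc; _∸_; _≤ᵇ_; _<ᵇ_; _≡ᵇ_)
  renaming (_+_ to _+ℕ_; _≤_ to _≤ℕ_; _<_ to _<ℕ_)
open import Data.Bool using (Bool; true; false; if_then_else_; _∧_)
open import Data.Product using (Σ; _×_; ∃)
open import Relation.Nullary using (¬_)
open import Algebra.Bundles using (CommutativeRing)
open import Algebra.Module.Bundles using (Module)

record Field (c ℓ : Level) : Set (lsuc (c ⊔ ℓ)) where
  field
    commutativeRing : CommutativeRing c ℓ
  open CommutativeRing commutativeRing public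
  field
    0≉1 : ¬ (0# ≈ 1#)
    inverse : ∀ x → ¬ (x ≈ 0#) → Σ Carrier (λ y → x * y ≈ 1#)

module Setting {c ℓ a ℓa : Level} (F : Field c ℓ)
               (V : Module (Field.commutativeRing F) a ℓa) where

  open Field F
  open Module V using (Carrierᴹ; _≈ᴹ_; _+ᴹ_; _*ₗ_; 0ᴹ; -ᴹ_)

  module Exports where
    open Field F public using (_≈_; 0#)
    open Module V public using (Carrierᴹ)

  -- sums  f a + f (a+1) + ... + f b  (empty, i.e. 0, if b < a)
  sumFromK : ℕ → ℕ → (ℕ → Carrier) → Carrier
  sumFromK a zero    f = 0#
  sumFromK a (suc n) f = f a + sumFromK (suc a) n f

  ΣK[_⋯_] : ℕ → ℕ → (ℕ → Carrier) → Carrier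
  ΣK[ a ⋯ b ] f = sumFromK a (suc b ∸ a) f

  sumFromV : ℕ → ℕ → (ℕ → Carrierᴹ) → Carrierᴹ
  sumFromV a zero    f = 0ᴹ
  sumFromV a (suc n) f = f a +ᴹ sumFromV (suc a) n f

  ΣV[_⋯_] : ℕ → ℕ → (ℕ → Carrierᴹ) → Carrierᴹ
  ΣV[ a ⋯ b ] f = sumFromV a (suc b ∸ a) f

  _∈[_⋯_] : ℕ → ℕ → ℕ → Set
  x ∈[ a ⋯ b ] = (a ≤ℕ x) × (x ≤ℕ b)

  record IsLinear (N : Carrierᴹ → Carrierᴹ) : Set (c ⊔ a ⊔ ℓa) where
    field
      cong  : ∀ {x y} → x ≈ᴹ y → N x ≈ᴹ N y
      additive : ∀ x y → N (x +ᴹ y) ≈ᴹ N x +ᴹ N y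
      homogeneous : ∀ (λ' : Carrier) x → N (λ' *ₗ x) ≈ᴹ λ' *ₗ N x

  pow : (Carrierᴹ → Carrierᴹ) → ℕ → Carrierᴹ → Carrierᴹ
  pow N zero    v = v
  pow N (suc n) v = N (pow N n v)

  Nilpotent : (Carrierᴹ → Carrierᴹ) → ℕ → Set (a ⊔ ℓa)
  Nilpotent N 𝔪 = ∀ v → pow N 𝔪 v ≈ᴹ 0ᴹ

  comb : (N : Carrierᴹ → Carrierᴹ) (𝔪 : ℕ) (k : ℕ → ℕ) (l : ℕ → ℕ → Carrierᴹ)
         (u0 : ℕ) (cf : ℕ → ℕ → ℕ → Carrier) → Carrierᴹ
  comb N 𝔪 k l u0 cf =
    ΣV[ u0 ⋯ 𝔪 ∸ 1 ] λ α → ΣV[ α +ℕ 2 ⋯ suc 𝔪 ] λ β → ΣV[ 1 ⋯ k β ] λ γ →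
      cf α β γ *ₗ pow N α (l β γ)

  -- the family N^α l_{β,γ} (u0 ≤ α ≤ 𝔪-1, α+2 ≤ β ≤ 𝔪+1, 1 ≤ γ ≤ k_β)
  -- is a basis of N^{u0} V: it is linearly independent and spans N^{u0} V
  -- (each of its members lies in N^{u0} V since α ≥ u0).
  IsBasisOfImage : (N : Carrierᴹ → Carrierᴹ) (𝔪 : ℕ) (k : ℕ → ℕ)
                   (l : ℕ → ℕ → Carrierᴹ) (u0 : ℕ) → Set (c ⊔ ℓ ⊔ a ⊔ ℓa)
  IsBasisOfImage N 𝔪 k l u0 =
    (∀ (cf : ℕ → ℕ → ℕ → Carrier) → comb N 𝔪 k l u0 cf ≈ᴹ 0ᴹ →
       ∀ α β γ → α ∈[ u0 ⋯ 𝔪 ∸ 1 ] → β ∈[ α +ℕ 2 ⋯ suc 𝔪 ] → γ ∈[ 1 ⋯ k β ] →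
       cf α β γ ≈ 0#)
    × (∀ v → ∃ λ (cf : ℕ → ℕ → ℕ → Carrier) → pow N u0 v ≈ᴹ comb N 𝔪 k l u0 cf)

  -- A matrix is given by its entries, indexed from 1.
  Mat : Set c
  Mat = ℕ → ℕ → Carrier

  MatFamily : Set c
  MatFamily = ℕ → ℕ → ℕ → ℕ → Mat

  IsSFamily : (N : Carrierᴹ → Carrierᴹ) (𝔪 : ℕ) (k : ℕ → ℕ)
              (l : ℕ → ℕ → Carrierᴹ) (S : MatFamily) → Set ℓa
  IsSFamily N 𝔪 k l S =
    ∀ u i → u ∈[ 1 ⋯ 𝔪 ] → i ∈[ 1 ⋯ k u ] →
      pow N (u ∸ 1) (l u i) ≈ᴹ
        -ᴹ (ΣV[ u ∸ 1 ⋯ 𝔪 ∸ 1 ] λ z → ΣV[ z +ℕ 2 ⋯ suc 𝔪 ] λ y → ΣV[ 1 ⋯ k y ] λ j →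
              S u (u ∸ 1) y z i j *ₗ pow N z (l y j))

  IsPFamily : (N : Carrierᴹ → Carrierᴹ) (𝔪 : ℕ) (k : ℕ → ℕ)
              (l : ℕ → ℕ → Carrierᴹ) (P : MatFamily) → Set ℓa
  IsPFamily N 𝔪 k l P =
    ∀ v u i → v ∈[ 0 ⋯ 𝔪 ∸ 1 ] → u ∈[ 1 ⋯ suc 𝔪 ] → i ∈[ 1 ⋯ k u ] →
      pow N v (l u i) ≈ᴹ
        -ᴹ (ΣV[ v ⋯ 𝔪 ∸ 1 ] λ z → ΣV[ z +ℕ 2 ⋯ suc 𝔪 ] λ y → ΣV[ 1 ⋯ k y ] λ j →
              P u v y z i j *ₗ pow N z (l y j))

  -- A skew k-block matrix, given blockwise:  M α β p q  is the (p,q)-entry of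
  -- the (α,β)-block (size k_α × k_{𝔪+2-β}), all indices starting at 1.
  BlockMat : Set c
  BlockMat = ℕ → ℕ → ℕ → ℕ → Carrier

  δ : ℕ → ℕ → Carrier
  δ p q = if p ≡ᵇ q then 1# else 0#

  Cmat : (𝔪 : ℕ) (S : MatFamily) → ℕ → BlockMat
  Cmat 𝔪 S i α β p q =
    if (2 ≤ᵇ β) ∧ ((suc 𝔪 ∸ β) ≤ᵇ i) ∧ (i <ᵇ 𝔪) ∧ ((i +ℕ 2) ≤ᵇ α)
      then S (𝔪 +ℕ 2 ∸ β) (suc 𝔪 ∸ β) α i q p
      else (if (α ≡ᵇ suc i) ∧ (β ≡ᵇ suc 𝔪 ∸ i) then δ p q else 0#)

  C̄mat : (𝔪 : ℕ) (P : MatFamily) → ℕ → BlockMat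
  C̄mat 𝔪 P i α β p q =
    if (i <ᵇ 𝔪) ∧ (α ≤ᵇ 𝔪 ∸ i) ∧ (β ≤ᵇ suc i)
      then - P α (𝔪 ∸ 1 ∸ i) (𝔪 +ℕ 2 ∸ β) (𝔪 ∸ β) p q
      else (if (α ≡ᵇ suc 𝔪 ∸ i) ∧ (β ≡ᵇ suc i) then δ p q else 0#)

  FreeBlock : (𝔪 i α β : ℕ) → Set
  FreeBlock 𝔪 i α β = (i ℕ.< 𝔪) × (α ≤ℕ 𝔪 ∸ i) × (β ≤ℕ suc i)

  -- (p,q)-entry of the (α,β)-block of  C^t · X  for skew k-block matrices C, X;
  -- here C^t has (α,δ)-block (C_{δ,α})^t of size k_{𝔪+2-α} × k_δ.
  transMul : (𝔪 : ℕ) (k : ℕ → ℕ) → BlockMat → BlockMat → BlockMat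
  transMul 𝔪 k C X α β p q =
    ΣK[ 1 ⋯ suc 𝔪 ] λ d → ΣK[ 1 ⋯ k d ] λ t → C d α t p * X d β t q

  -- coefficient of N^j in  B(S)^t · X = (Σ_a C_a^t N^a)(Σ_b X_b N^b),  for j ≤ 𝔪
  prodCoeff : (𝔪 : ℕ) (k : ℕ → ℕ) (S : MatFamily) (X : ℕ → BlockMat) → ℕ → BlockMat
  prodCoeff 𝔪 k S X j α β p q =
    ΣK[ 0 ⋯ j ] λ a' → transMul 𝔪 k (Cmat 𝔪 S a') (X (j ∸ a')) α β p q

-- B̄(S) satisfies the hypothesis: the blocks of C̄_i record the coordinates of the vectors
-- N^{𝔪-1-i} l_{d,t} in the basis (N^z l_{y,s}) of N^v V, so a coefficient of N^j (j < 𝔪) of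
-- B(S)^t B̄(S) is a coordinate of N^{𝔪-1-j} applied to a relation that defines S, which is 0;
-- by linear independence the coefficient vanishes.  For uniqueness, Δ = X - B̄(S) is supported
-- on the free blocks, and in the coefficient of N^{i+a} of B(S)^t Δ at block (𝔪+1-a, β) the block
-- (a+1, β) of Δ_i meets an identity entry of C_a, while all other terms involve Δ_{i'} with
-- i' < i or blocks of Δ_i below row a+1.  Induction on i, and downwards on the row, gives Δ = 0.

module Submission where

open import Defs
open import Level using (Level)
open import Data.Nat using (ℕ; zero; suc; _+_; _∸_; _≤_; _<_; z≤n; s≤s; _≤ᵇ_; _<ᵇ_; _≡ᵇ_)
open import Data.Nat.Properties
  using (≤-refl; ≤-trans; <⇒≤; ≤-pred; <-irrefl; n≤1+n; m≤n⇒m≤1+n; m≤n+m; m≤m+n; <⇒≱; ≰⇒>;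
         +-suc; m∸n+n≡m; m+n∸n≡m; m+[n∸m]≡n; m∸[m∸n]≡n; m≤n⇒m∸n≡0; n∸n≡0;
         +-∸-assoc; +-∸-comm; ∸-+-assoc; m∸n≤m; m+n≤o⇒m≤o∸n; ∸-monoʳ-≤; ∸-monoʳ-<;
         +-monoʳ-≤; +-monoˡ-≤; +-monoʳ-<; +-cancelʳ-<; m≤n⇒m<n∨m≡n;
         _≤?_; _<?_; _≟_; ≮⇒≥; ≡ᵇ⇒≡; ≤ᵇ⇒≤)
import Data.Nat.Properties as ℕ
open import Data.Nat.Induction using (<-rec)
open import Data.Bool using (Bool; true; false; T; if_then_else_; _∧_)
open import Data.Bool.Properties using (∧-zeroʳ)
open import Data.Product using (_×_; _,_; proj₁; proj₂)
open import Data.Sum using (_⊎_; inj₁; inj₂; [_,_])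
open import Data.Empty using (⊥-elim)
open import Function using (_∘_)
open import Relation.Nullary using (¬_; yes; no)
open import Relation.Nullary.Decidable using (dec-true; dec-false)
open import Relation.Binary.PropositionalEquality as P using (_≡_; _≢_)
open import Algebra.Bundles using (CommutativeMonoid)
import Relation.Binary.Reasoning.Setoid as SetoidReasoning
open import Algebra.Module.Bundles using (Module)

if-true : ∀ {a} {A : Set a} {b} {x y : A} → b ≡ true → (if b then x else y) ≡ x
if-true P.refl = P.refl

if-false : ∀ {a} {A : Set a} {b} {x y : A} → b ≡ false → (if b then x else y) ≡ y
if-false P.refl = P.refl

∧-true : ∀ {b₁ b₂} → b₁ ≡ true → b₂ ≡ true → (b₁ ∧ b₂) ≡ true
∧-true P.refl P.refl = P.refl

∧-true⁻¹ : ∀ {b₁ b₂} → (b₁ ∧ b₂) ≡ true → (b₁ ≡ true) × (b₂ ≡ true)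
∧-true⁻¹ {true} b₂≡true = P.refl , b₂≡true

∧-falseˡ : ∀ {b₁} b₂ → b₁ ≡ false → (b₁ ∧ b₂) ≡ false
∧-falseˡ _ P.refl = P.refl

∧-falseʳ : ∀ b₁ {b₂} → b₂ ≡ false → (b₁ ∧ b₂) ≡ false
∧-falseʳ b₁ P.refl = ∧-zeroʳ b₁

≡⇒≡ᵇ-true : ∀ {m n} → m ≡ n → (m ≡ᵇ n) ≡ true
≡⇒≡ᵇ-true {m} {n} = dec-true (m ≟ n)

≢⇒≡ᵇ-false : ∀ {m n} → m ≢ n → (m ≡ᵇ n) ≡ false
≢⇒≡ᵇ-false {m} {n} = dec-false (m ≟ n)

≤⇒≤ᵇ-true : ∀ {m n} → m ≤ n → (m ≤ᵇ n) ≡ true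
≤⇒≤ᵇ-true {m} {n} = dec-true (m ≤? n)

≰⇒≤ᵇ-false : ∀ {m n} → ¬ m ≤ n → (m ≤ᵇ n) ≡ false
≰⇒≤ᵇ-false {m} {n} = dec-false (m ≤? n)

<⇒<ᵇ-true : ∀ {m n} → m < n → (m <ᵇ n) ≡ true
<⇒<ᵇ-true {m} {n} = dec-true (m <? n)

≡ᵇ-true⇒≡ : ∀ m n → (m ≡ᵇ n) ≡ true → m ≡ n
≡ᵇ-true⇒≡ m n e = ≡ᵇ⇒≡ m n (P.subst T (P.sym e) _)

≤ᵇ-true⇒≤ : ∀ m n → (m ≤ᵇ n) ≡ true → m ≤ n
≤ᵇ-true⇒≤ m n e = ≤ᵇ⇒≤ m n (P.subst T (P.sym e) _)

<⇒≤∸1 : ∀ {m n} → m < n → m ≤ n ∸ 1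
<⇒≤∸1 (s≤s m≤n) = m≤n

≤∸1⇒< : ∀ {m n} → 1 ≤ n → m ≤ n ∸ 1 → m < n
≤∸1⇒< {n = suc n} _ m≤n = s≤s m≤n

[m∸1∸n]+[1+n]≡m : ∀ m n → n < m → (m ∸ 1 ∸ n) + suc n ≡ m
[m∸1∸n]+[1+n]≡m (suc m) n (s≤s n≤m) = P.trans (+-suc (m ∸ n) n) (P.cong suc (m∸n+n≡m n≤m))

m∸n≡1+[m∸1∸n] : ∀ m n → n < m → m ∸ n ≡ suc (m ∸ 1 ∸ n)
m∸n≡1+[m∸1∸n] (suc m) n (s≤s n≤m) = +-∸-assoc 1 n≤m

m+2∸n≡1+[1+m∸n] : ∀ m n → n ≤ suc m → m + 2 ∸ n ≡ suc (suc m ∸ n)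
m+2∸n≡1+[1+m∸n] m n n≤1+m = P.trans (P.cong (_∸ n) (ℕ.+-comm m 2)) (+-∸-assoc 1 n≤1+m)

m+2∸[1+n]≡1+m∸n : ∀ m n → m + 2 ∸ suc n ≡ suc m ∸ n
m+2∸[1+n]≡1+m∸n m n = P.cong (_∸ suc n) (ℕ.+-comm m 2)

m∸1∸[n∸o]≡[m∸1∸n]+o : ∀ m n o → n < m → o ≤ n → m ∸ 1 ∸ (n ∸ o) ≡ (m ∸ 1 ∸ n) + o
m∸1∸[n∸o]≡[m∸1∸n]+o m n o n<m o≤n =
  P.trans (P.cong (_∸ (n ∸ o)) m∸1≡) (m+n∸n≡m ((m ∸ 1 ∸ n) + o) (n ∸ o))
  where
  m∸1≡ : m ∸ 1 ≡ ((m ∸ 1 ∸ n) + o) + (n ∸ o)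
  m∸1≡ = P.sym (P.trans (ℕ.+-assoc (m ∸ 1 ∸ n) o (n ∸ o))
           (P.trans (P.cong ((m ∸ 1 ∸ n) +_) (m+[n∸m]≡n o≤n)) (m∸n+n≡m (<⇒≤∸1 n<m))))

[m+n]∸o<m : ∀ m n o → n < o → o ≤ m + n → (m + n) ∸ o < m
[m+n]∸o<m m n o n<o o≤m+n =
  +-cancelʳ-< o ((m + n) ∸ o) m (P.subst (_< m + o) (P.sym (m∸n+n≡m o≤m+n)) (+-monoʳ-< m n<o))

[m+n]∸o≤m : ∀ m n o → n ≤ o → (m + n) ∸ o ≤ m
[m+n]∸o≤m m n o n≤o = P.subst ((m + n) ∸ o ≤_) (m+n∸n≡m m n) (∸-monoʳ-≤ (m + n) n≤o)

n≤1+o⇒m∸1∸o≤m∸n : ∀ m n o → n ≤ suc o → m ∸ 1 ∸ o ≤ m ∸ n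
n≤1+o⇒m∸1∸o≤m∸n m n o n≤1+o = P.subst (_≤ m ∸ n) (P.sym (∸-+-assoc m 1 o)) (∸-monoʳ-≤ m n≤1+o)

n≰1+o⇒m∸1∸o≰m∸n : ∀ m n o → n ≤ m → ¬ n ≤ suc o → ¬ (m ∸ 1 ∸ o ≤ m ∸ n)
n≰1+o⇒m∸1∸o≰m∸n m n o n≤m n≰1+o le =
  <⇒≱ (∸-monoʳ-< (≰⇒> n≰1+o) n≤m) (P.subst (_≤ m ∸ n) (∸-+-assoc m 1 o) le)

n≢1+o⇒m∸1∸o≢m∸n : ∀ m n o → n ≤ m → suc o ≤ m → n ≢ suc o → m ∸ 1 ∸ o ≢ m ∸ n
n≢1+o⇒m∸1∸o≢m∸n m n o n≤m 1+o≤m n≢1+o e = n≢1+o (P.trans (P.sym (m∸[m∸n]≡n n≤m))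
  (P.trans (P.cong (m ∸_) (P.sym (P.trans (P.sym (∸-+-assoc m 1 o)) e))) (m∸[m∸n]≡n 1+o≤m)))

m<[1+n∸o]+o⇒m≤n : ∀ {m} n {o} → o ≤ m → m < (suc n ∸ o) + o → m ≤ n
m<[1+n∸o]+o⇒m≤n {m} n {o} o≤m m< with o ≤? suc n
... | yes o≤1+n = ≤-pred (P.subst (m <_) (m∸n+n≡m o≤1+n) m<)
... | no o≰1+n  = ⊥-elim (<⇒≱ (P.subst (λ z → m < z + o) (m≤n⇒m∸n≡0 (<⇒≤ (≰⇒> o≰1+n))) m<) o≤m)

-- Defs defines sums of scalars and of vectors by two separate recursions; abstracting over the
-- defining equations lets one development serve both.
module IntervalSums {c ℓ : Level} (M : CommutativeMonoid c ℓ)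
  (sumFrom : ℕ → ℕ → (ℕ → CommutativeMonoid.Carrier M) → CommutativeMonoid.Carrier M)
  (sumFrom-0 : ∀ a f → CommutativeMonoid._≈_ M (sumFrom a 0 f) (CommutativeMonoid.ε M))
  (sumFrom-suc : ∀ a n f → CommutativeMonoid._≈_ M (sumFrom a (suc n) f)
                             (CommutativeMonoid._∙_ M (f a) (sumFrom (suc a) n f))) where

  open CommutativeMonoid M
  open import Algebra.Properties.CommutativeSemigroup commutativeSemigroup using (interchange)
  open SetoidReasoning setoid

  Σ[_⋯_] : ℕ → ℕ → (ℕ → Carrier) → Carrier
  Σ[ a ⋯ b ] f = sumFrom a (suc b ∸ a) f

  sumFrom-cong : ∀ a n {f g} → (∀ x → a ≤ x → x < n + a → f x ≈ g x) →
                 sumFrom a n f ≈ sumFrom a n g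
  sumFrom-cong a zero h = trans (sumFrom-0 a _) (sym (sumFrom-0 a _))
  sumFrom-cong a (suc n) {f} {g} h = begin
    sumFrom a (suc n) f    ≈⟨ sumFrom-suc a n f ⟩
    f a ∙ sumFrom (suc a) n f
      ≈⟨ ∙-cong (h a ≤-refl (s≤s (m≤n+m a n)))
                (sumFrom-cong (suc a) n (λ x a<x x<n → h x (<⇒≤ a<x) (P.subst (x <_) (+-suc n a) x<n))) ⟩
    g a ∙ sumFrom (suc a) n g ≈⟨ sym (sumFrom-suc a n g) ⟩
    sumFrom a (suc n) g    ∎

  Σ-cong : ∀ a b {f g} → (∀ x → a ≤ x → x ≤ b → f x ≈ g x) → Σ[ a ⋯ b ] f ≈ Σ[ a ⋯ b ] g
  Σ-cong a b h = sumFrom-cong a _ (λ x a≤x x< → h x a≤x (m<[1+n∸o]+o⇒m≤n b a≤x x<))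

  sumFrom-ε : ∀ a n {f} → (∀ x → a ≤ x → x < n + a → f x ≈ ε) → sumFrom a n f ≈ ε
  sumFrom-ε a zero h = sumFrom-0 a _
  sumFrom-ε a (suc n) {f} h = begin
    sumFrom a (suc n) f       ≈⟨ sumFrom-suc a n f ⟩
    f a ∙ sumFrom (suc a) n f
      ≈⟨ ∙-cong (h a ≤-refl (s≤s (m≤n+m a n)))
                (sumFrom-ε (suc a) n (λ x a<x x<n → h x (<⇒≤ a<x) (P.subst (x <_) (+-suc n a) x<n))) ⟩
    ε ∙ ε                     ≈⟨ identityˡ ε ⟩
    ε                         ∎

  Σ-ε : ∀ a b {f} → (∀ x → a ≤ x → x ≤ b → f x ≈ ε) → Σ[ a ⋯ b ] f ≈ ε
  Σ-ε a b h = sumFrom-ε a _ (λ x a≤x x< → h x a≤x (m<[1+n∸o]+o⇒m≤n b a≤x x<))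

  sumFrom-distrib : ∀ a n f g → sumFrom a n (λ x → f x ∙ g x) ≈ sumFrom a n f ∙ sumFrom a n g
  sumFrom-distrib a zero f g =
    trans (sumFrom-0 a _) (sym (trans (∙-cong (sumFrom-0 a f) (sumFrom-0 a g)) (identityˡ ε)))
  sumFrom-distrib a (suc n) f g = begin
    sumFrom a (suc n) (λ x → f x ∙ g x)
      ≈⟨ sumFrom-suc a n _ ⟩
    (f a ∙ g a) ∙ sumFrom (suc a) n (λ x → f x ∙ g x)
      ≈⟨ ∙-congˡ (sumFrom-distrib (suc a) n f g) ⟩
    (f a ∙ g a) ∙ (sumFrom (suc a) n f ∙ sumFrom (suc a) n g)
      ≈⟨ interchange _ _ _ _ ⟩
    (f a ∙ sumFrom (suc a) n f) ∙ (g a ∙ sumFrom (suc a) n g)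
      ≈⟨ sym (∙-cong (sumFrom-suc a n f) (sumFrom-suc a n g)) ⟩
    sumFrom a (suc n) f ∙ sumFrom a (suc n) g
      ∎

  sumFrom-comm : ∀ a n b m (f : ℕ → ℕ → Carrier) →
    sumFrom a n (λ x → sumFrom b m (f x)) ≈ sumFrom b m (λ y → sumFrom a n (λ x → f x y))
  sumFrom-comm a zero b m f =
    trans (sumFrom-0 a _) (sym (sumFrom-ε b m (λ _ _ _ → sumFrom-0 a _)))
  sumFrom-comm a (suc n) b m f = begin
    sumFrom a (suc n) (λ x → sumFrom b m (f x))
      ≈⟨ sumFrom-suc a n _ ⟩
    sumFrom b m (f a) ∙ sumFrom (suc a) n (λ x → sumFrom b m (f x))
      ≈⟨ ∙-congˡ (sumFrom-comm (suc a) n b m f) ⟩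
    sumFrom b m (f a) ∙ sumFrom b m (λ y → sumFrom (suc a) n (λ x → f x y))
      ≈⟨ sym (sumFrom-distrib b m _ _) ⟩
    sumFrom b m (λ y → f a y ∙ sumFrom (suc a) n (λ x → f x y))
      ≈⟨ sumFrom-cong b m (λ y _ _ → sym (sumFrom-suc a n _)) ⟩
    sumFrom b m (λ y → sumFrom a (suc n) (λ x → f x y))
      ∎

  sumFrom-snoc : ∀ a n f → sumFrom a (suc n) f ≈ sumFrom a n f ∙ f (n + a)
  sumFrom-snoc a zero f = begin
    sumFrom a 1 f           ≈⟨ sumFrom-suc a 0 f ⟩
    f a ∙ sumFrom (suc a) 0 f ≈⟨ ∙-congˡ (sumFrom-0 (suc a) f) ⟩
    f a ∙ ε                 ≈⟨ comm _ _ ⟩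
    ε ∙ f a                 ≈⟨ ∙-congʳ (sym (sumFrom-0 a f)) ⟩
    sumFrom a 0 f ∙ f a     ∎
  sumFrom-snoc a (suc n) f = begin
    sumFrom a (suc (suc n)) f                   ≈⟨ sumFrom-suc a (suc n) f ⟩
    f a ∙ sumFrom (suc a) (suc n) f             ≈⟨ ∙-congˡ (sumFrom-snoc (suc a) n f) ⟩
    f a ∙ (sumFrom (suc a) n f ∙ f (n + suc a)) ≈⟨ sym (assoc _ _ _) ⟩
    (f a ∙ sumFrom (suc a) n f) ∙ f (n + suc a)
      ≈⟨ ∙-cong (sym (sumFrom-suc a n f)) (reflexive (P.cong f (+-suc n a))) ⟩
    sumFrom a (suc n) f ∙ f (suc n + a)         ∎

  Σ-trimˡ : ∀ b k a → k + a ≤ suc b → (f : ℕ → Carrier) →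
            (∀ x → a ≤ x → x < k + a → f x ≈ ε) → Σ[ a ⋯ b ] f ≈ Σ[ k + a ⋯ b ] f
  Σ-trimˡ b zero a _ f h = refl
  Σ-trimˡ b (suc k) a k+a≤ f h = begin
    sumFrom a (suc b ∸ a) f     ≡⟨ P.cong (λ n → sumFrom a n f) (+-∸-assoc 1 a≤b) ⟩
    sumFrom a (suc (b ∸ a)) f   ≈⟨ sumFrom-suc a _ f ⟩
    f a ∙ Σ[ suc a ⋯ b ] f      ≈⟨ ∙-congʳ (h a ≤-refl (s≤s (m≤n+m a k))) ⟩
    ε ∙ Σ[ suc a ⋯ b ] f        ≈⟨ identityˡ _ ⟩
    Σ[ suc a ⋯ b ] f
      ≈⟨ Σ-trimˡ b k (suc a) (P.subst (_≤ suc b) (P.sym (+-suc k a)) k+a≤) f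
                 (λ x a<x x< → h x (<⇒≤ a<x) (P.subst (x <_) (+-suc k a) x<)) ⟩
    Σ[ k + suc a ⋯ b ] f        ≡⟨ P.cong (λ z → Σ[ z ⋯ b ] f) (+-suc k a) ⟩
    Σ[ suc k + a ⋯ b ] f        ∎
    where
    a≤b : a ≤ b
    a≤b = ≤-pred (≤-trans (s≤s (m≤n+m a k)) k+a≤)

  Σ-trimʳ : ∀ a b k → a ≤ suc b → (f : ℕ → Carrier) →
            (∀ x → b < x → x ≤ k + b → f x ≈ ε) → Σ[ a ⋯ k + b ] f ≈ Σ[ a ⋯ b ] f
  Σ-trimʳ a b zero _ f h = refl
  Σ-trimʳ a b (suc k) a≤ f h = begin
    sumFrom a (suc (suc (k + b)) ∸ a) f   ≡⟨ P.cong (λ n → sumFrom a n f) (+-∸-assoc 1 a≤k+b+1) ⟩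
    sumFrom a (suc (suc (k + b) ∸ a)) f   ≈⟨ sumFrom-snoc a _ f ⟩
    Σ[ a ⋯ k + b ] f ∙ f ((suc (k + b) ∸ a) + a)
      ≈⟨ ∙-congˡ (trans (reflexive (P.cong f (m∸n+n≡m a≤k+b+1))) (h _ (s≤s (m≤n+m b k)) ≤-refl)) ⟩
    Σ[ a ⋯ k + b ] f ∙ ε                  ≈⟨ identityʳ _ ⟩
    Σ[ a ⋯ k + b ] f                      ≈⟨ Σ-trimʳ a b k a≤ f (λ x b<x x≤ → h x b<x (m≤n⇒m≤1+n x≤)) ⟩
    Σ[ a ⋯ b ] f                          ∎
    where
    a≤k+b+1 : a ≤ suc (k + b)
    a≤k+b+1 = ≤-trans a≤ (s≤s (m≤n+m b k))

  Σ-restrict : ∀ a b a' b' → a ≤ a' → a' ≤ suc b' → b' ≤ b → (f : ℕ → Carrier) →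
    (∀ x → a ≤ x → x ≤ b → (x < a' ⊎ b' < x) → f x ≈ ε) → Σ[ a ⋯ b ] f ≈ Σ[ a' ⋯ b' ] f
  Σ-restrict a b a' b' a≤a' a'≤ b'≤b f h = begin
    Σ[ a ⋯ b ] f                ≡⟨ P.cong (λ z → Σ[ a ⋯ z ] f) (P.sym (m∸n+n≡m b'≤b)) ⟩
    Σ[ a ⋯ (b ∸ b') + b' ] f
      ≈⟨ Σ-trimʳ a b' (b ∸ b') (≤-trans a≤a' a'≤) f
          (λ x b'<x x≤ → h x (≤-trans a≤a' (≤-trans a'≤ b'<x)) (P.subst (x ≤_) (m∸n+n≡m b'≤b) x≤)
                          (inj₂ b'<x)) ⟩
    Σ[ a ⋯ b' ] f
      ≈⟨ Σ-trimˡ b' (a' ∸ a) a (P.subst (_≤ suc b') (P.sym (m∸n+n≡m a≤a')) a'≤) f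
          (λ x a≤x x< → let x<a' = P.subst (x <_) (m∸n+n≡m a≤a') x< in
                          h x a≤x (≤-trans (≤-pred (≤-trans x<a' a'≤)) b'≤b) (inj₁ x<a')) ⟩
    Σ[ (a' ∸ a) + a ⋯ b' ] f    ≡⟨ P.cong (λ z → Σ[ z ⋯ b' ] f) (m∸n+n≡m a≤a') ⟩
    Σ[ a' ⋯ b' ] f              ∎

  Σ-single : ∀ a b x₀ → a ≤ x₀ → x₀ ≤ b → (f : ℕ → Carrier) →
    (∀ x → a ≤ x → x ≤ b → x ≢ x₀ → f x ≈ ε) → Σ[ a ⋯ b ] f ≈ f x₀
  Σ-single a b x₀ a≤x₀ x₀≤b f h = begin
    Σ[ a ⋯ b ] f
      ≈⟨ Σ-restrict a b x₀ x₀ a≤x₀ (n≤1+n x₀) x₀≤b f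
          (λ x a≤x x≤b out → h x a≤x x≤b (λ { P.refl → [ <-irrefl P.refl , <-irrefl P.refl ] out })) ⟩
    sumFrom x₀ (suc x₀ ∸ x₀) f  ≡⟨ P.cong (λ n → sumFrom x₀ n f) (+-∸-assoc 1 (≤-refl {x₀})) ⟩
    sumFrom x₀ (suc (x₀ ∸ x₀)) f ≡⟨ P.cong (λ n → sumFrom x₀ (suc n) f) (n∸n≡0 x₀) ⟩
    sumFrom x₀ 1 f              ≈⟨ sumFrom-suc x₀ 0 f ⟩
    f x₀ ∙ sumFrom (suc x₀) 0 f ≈⟨ ∙-congˡ (sumFrom-0 _ f) ⟩
    f x₀ ∙ ε                    ≈⟨ identityʳ _ ⟩
    f x₀                        ∎

  sumFrom³-cong : ∀ a n (b m : ℕ → ℕ) (c r : ℕ → ℕ → ℕ) {f g : ℕ → ℕ → ℕ → Carrier} →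
    (∀ x y z → f x y z ≈ g x y z) →
    sumFrom a n (λ x → sumFrom (b x) (m x) (λ y → sumFrom (c x y) (r x y) (f x y))) ≈
    sumFrom a n (λ x → sumFrom (b x) (m x) (λ y → sumFrom (c x y) (r x y) (g x y)))
  sumFrom³-cong a n b m c r h =
    sumFrom-cong a n (λ x _ _ → sumFrom-cong (b x) (m x) (λ y _ _ →
      sumFrom-cong (c x y) (r x y) (λ z _ _ → h x y z)))

  sumFrom³-distrib : ∀ a n (b m : ℕ → ℕ) (c r : ℕ → ℕ → ℕ) (f g : ℕ → ℕ → ℕ → Carrier) →
    sumFrom a n (λ x → sumFrom (b x) (m x) (λ y → sumFrom (c x y) (r x y) (λ z → f x y z ∙ g x y z))) ≈
    sumFrom a n (λ x → sumFrom (b x) (m x) (λ y → sumFrom (c x y) (r x y) (f x y))) ∙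
    sumFrom a n (λ x → sumFrom (b x) (m x) (λ y → sumFrom (c x y) (r x y) (g x y)))
  sumFrom³-distrib a n b m c r f g =
    trans (sumFrom-cong a n (λ x _ _ →
             trans (sumFrom-cong (b x) (m x) (λ y _ _ → sumFrom-distrib (c x y) (r x y) (f x y) (g x y)))
                   (sumFrom-distrib (b x) (m x) _ _)))
          (sumFrom-distrib a n _ _)

module IntervalSumHomomorphism {c₁ ℓ₁ c₂ ℓ₂ : Level}
  (M₁ : CommutativeMonoid c₁ ℓ₁) (M₂ : CommutativeMonoid c₂ ℓ₂)
  (sum₁ : ℕ → ℕ → (ℕ → CommutativeMonoid.Carrier M₁) → CommutativeMonoid.Carrier M₁)
  (sum₂ : ℕ → ℕ → (ℕ → CommutativeMonoid.Carrier M₂) → CommutativeMonoid.Carrier M₂)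
  (sum₁-0 : ∀ a f → CommutativeMonoid._≈_ M₁ (sum₁ a 0 f) (CommutativeMonoid.ε M₁))
  (sum₁-suc : ∀ a n f → CommutativeMonoid._≈_ M₁ (sum₁ a (suc n) f)
                          (CommutativeMonoid._∙_ M₁ (f a) (sum₁ (suc a) n f)))
  (sum₂-0 : ∀ a f → CommutativeMonoid._≈_ M₂ (sum₂ a 0 f) (CommutativeMonoid.ε M₂))
  (sum₂-suc : ∀ a n f → CommutativeMonoid._≈_ M₂ (sum₂ a (suc n) f)
                          (CommutativeMonoid._∙_ M₂ (f a) (sum₂ (suc a) n f)))
  (h : CommutativeMonoid.Carrier M₁ → CommutativeMonoid.Carrier M₂)
  (h-cong : ∀ {x y} → CommutativeMonoid._≈_ M₁ x y → CommutativeMonoid._≈_ M₂ (h x) (h y))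
  (h-ε : CommutativeMonoid._≈_ M₂ (h (CommutativeMonoid.ε M₁)) (CommutativeMonoid.ε M₂))
  (h-∙ : ∀ x y → CommutativeMonoid._≈_ M₂ (h (CommutativeMonoid._∙_ M₁ x y))
                   (CommutativeMonoid._∙_ M₂ (h x) (h y))) where

  open CommutativeMonoid M₂

  sumFrom-hom : ∀ a n f → h (sum₁ a n f) ≈ sum₂ a n (λ x → h (f x))
  sumFrom-hom a zero f = trans (h-cong (sum₁-0 a f)) (trans h-ε (sym (sum₂-0 a _)))
  sumFrom-hom a (suc n) f =
    trans (h-cong (sum₁-suc a n f))
          (trans (h-∙ _ _) (trans (∙-congˡ (sumFrom-hom (suc a) n f)) (sym (sum₂-suc a n _))))

module _ {c ℓ a ℓa : Level} (F : Field c ℓ) (V : Module (Field.commutativeRing F) a ℓa) where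

  open Setting F V
  open Field F renaming (_+_ to _+ᶠ_; _*_ to _*ᶠ_)
  open Module V
  open import Algebra.Module.Properties V using (x≈0⇒x*y≈0; y≈0⇒x*y≈0)
  module ᴹ-Reasoning = SetoidReasoning ≈ᴹ-setoid
  module ᶠ-Reasoning = SetoidReasoning setoid

  module 𝕂 = IntervalSums +-commutativeMonoid sumFromK (λ _ _ → refl) (λ _ _ _ → refl)
  module 𝕍 = IntervalSums +ᴹ-commutativeMonoid sumFromV (λ _ _ → ≈ᴹ-refl) (λ _ _ _ → ≈ᴹ-refl)

  private
    module 𝕂⇒𝕍 = IntervalSumHomomorphism +-commutativeMonoid +ᴹ-commutativeMonoid sumFromK sumFromV
      (λ _ _ → refl) (λ _ _ _ → refl) (λ _ _ → ≈ᴹ-refl) (λ _ _ _ → ≈ᴹ-refl)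
    module 𝕍⇒𝕍 = IntervalSumHomomorphism +ᴹ-commutativeMonoid +ᴹ-commutativeMonoid sumFromV sumFromV
      (λ _ _ → ≈ᴹ-refl) (λ _ _ _ → ≈ᴹ-refl) (λ _ _ → ≈ᴹ-refl) (λ _ _ _ → ≈ᴹ-refl)

  -‿*ₗ : ∀ λ' x → (- λ') *ₗ x ≈ᴹ -ᴹ (λ' *ₗ x)
  -‿*ₗ λ' x = inverseʳ-unique (λ' *ₗ x) ((- λ') *ₗ x) (begin
    λ' *ₗ x +ᴹ (- λ') *ₗ x ≈⟨ ≈ᴹ-sym (*ₗ-distribʳ x λ' (- λ')) ⟩
    (λ' +ᶠ - λ') *ₗ x      ≈⟨ *ₗ-congʳ (-‿inverseʳ λ') ⟩
    0# *ₗ x                ≈⟨ *ₗ-zeroˡ x ⟩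
    0ᴹ                     ∎)
    where
    open import Algebra.Properties.Group +ᴹ-group using (inverseʳ-unique)
    open ᴹ-Reasoning

  sumFromK-*ₗ : ∀ a n f x → sumFromK a n f *ₗ x ≈ᴹ sumFromV a n (λ i → f i *ₗ x)
  sumFromK-*ₗ a n f x =
    𝕂⇒𝕍.sumFrom-hom (_*ₗ x) *ₗ-congʳ (*ₗ-zeroˡ x) (λ u v → *ₗ-distribʳ x u v) a n f

  *ₗ-sumFromV : ∀ λ' a n f → λ' *ₗ sumFromV a n f ≈ᴹ sumFromV a n (λ i → λ' *ₗ f i)
  *ₗ-sumFromV λ' = 𝕍⇒𝕍.sumFrom-hom (λ' *ₗ_) *ₗ-congˡ (*ₗ-zeroʳ λ') (*ₗ-distribˡ λ')

  -ᴹ-sumFromV : ∀ a n f → -ᴹ sumFromV a n f ≈ᴹ sumFromV a n (λ i → -ᴹ f i)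
  -ᴹ-sumFromV = 𝕍⇒𝕍.sumFrom-hom -ᴹ_ -ᴹ‿cong ε⁻¹≈ε (λ x y → ≈ᴹ-sym (⁻¹-∙-comm x y))
    where
    open import Algebra.Properties.Group +ᴹ-group using (ε⁻¹≈ε)
    open import Algebra.Properties.AbelianGroup +ᴹ-abelianGroup using (⁻¹-∙-comm)

  module _ (𝔪 : ℕ) where

    -- Coordinates of N^w l_{d,t} at N^z l_{y,s} in the basis of N^v V (any v ≤ w): read off the
    -- P-relation when d ≤ w + 1, and otherwise N^w l_{d,t} is itself a basis vector.
    powCoords : MatFamily → ℕ → ℕ → ℕ → ℕ → ℕ → ℕ → Carrier
    powCoords P w d t z y s =
      if d ≤ᵇ suc w then (if w ≤ᵇ z then - P d w y z t s else 0#)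
      else (if (w ≡ᵇ z) ∧ (d ≡ᵇ y) then δ t s else 0#)

    powCoords-below : ∀ P w d t z y s → z < w → powCoords P w d t z y s ≈ 0#
    powCoords-below P w d t z y s z<w with d ≤? suc w
    ... | yes d≤1+w = reflexive (P.trans (if-true (≤⇒≤ᵇ-true d≤1+w)) (if-false (≰⇒≤ᵇ-false (<⇒≱ z<w))))
    ... | no d≰1+w  = reflexive (P.trans (if-false (≰⇒≤ᵇ-false d≰1+w))
                        (if-false (∧-falseˡ (d ≡ᵇ y) (≢⇒≡ᵇ-false (λ e → <-irrefl (P.sym e) z<w)))))

    C̄mat≈powCoords-relation : ∀ P i d β t q → i < 𝔪 → β ≤ 𝔪 → d ≤ 𝔪 ∸ i →
      C̄mat 𝔪 P i d β t q ≈ powCoords P (𝔪 ∸ 1 ∸ i) d t (𝔪 ∸ β) (𝔪 + 2 ∸ β) q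
    C̄mat≈powCoords-relation P i d β t q i<𝔪 β≤𝔪 d≤𝔪∸i with β ≤? suc i
    ... | yes β≤ = reflexive (P.trans
            (if-true (∧-true (<⇒<ᵇ-true i<𝔪) (∧-true (≤⇒≤ᵇ-true d≤𝔪∸i) (≤⇒≤ᵇ-true β≤))))
            (P.sym (P.trans (if-true (≤⇒≤ᵇ-true d≤)) (if-true (≤⇒≤ᵇ-true (n≤1+o⇒m∸1∸o≤m∸n 𝔪 β i β≤))))))
      where
      d≤ : d ≤ suc (𝔪 ∸ 1 ∸ i)
      d≤ = P.subst (d ≤_) (m∸n≡1+[m∸1∸n] 𝔪 i i<𝔪) d≤𝔪∸i
    ... | no β≰ = reflexive (P.trans
            (P.trans (if-false (∧-falseʳ (i <ᵇ 𝔪) (∧-falseʳ (d ≤ᵇ 𝔪 ∸ i) (≰⇒≤ᵇ-false β≰))))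
                     (if-false (∧-falseˡ (β ≡ᵇ suc i) (≢⇒≡ᵇ-false d≢))))
            (P.sym (P.trans (if-true (≤⇒≤ᵇ-true d≤)) (if-false (≰⇒≤ᵇ-false (n≰1+o⇒m∸1∸o≰m∸n 𝔪 β i β≤𝔪 β≰))))))
      where
      d≤ : d ≤ suc (𝔪 ∸ 1 ∸ i)
      d≤ = P.subst (d ≤_) (m∸n≡1+[m∸1∸n] 𝔪 i i<𝔪) d≤𝔪∸i
      d≢ : d ≢ suc 𝔪 ∸ i
      d≢ d≡ = <-irrefl P.refl (P.subst (_≤ 𝔪 ∸ i) (P.trans d≡ (+-∸-assoc 1 (<⇒≤ i<𝔪))) d≤𝔪∸i)

    C̄mat≈powCoords-basisVector : ∀ P i d β t q → i < 𝔪 → β ≤ 𝔪 → ¬ d ≤ 𝔪 ∸ i →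
      C̄mat 𝔪 P i d β t q ≈ powCoords P (𝔪 ∸ 1 ∸ i) d t (𝔪 ∸ β) (𝔪 + 2 ∸ β) q
    C̄mat≈powCoords-basisVector P i d β t q i<𝔪 β≤𝔪 d≰𝔪∸i with β ≟ suc i
    ... | no β≢ = reflexive (P.trans
            (P.trans (if-false (∧-falseʳ (i <ᵇ 𝔪) (∧-falseˡ (β ≤ᵇ suc i) (≰⇒≤ᵇ-false d≰𝔪∸i))))
                     (if-false (∧-falseʳ (d ≡ᵇ suc 𝔪 ∸ i) (≢⇒≡ᵇ-false β≢))))
            (P.sym (P.trans (if-false d≰)
              (if-false (∧-falseˡ (d ≡ᵇ 𝔪 + 2 ∸ β) (≢⇒≡ᵇ-false (n≢1+o⇒m∸1∸o≢m∸n 𝔪 β i β≤𝔪 i<𝔪 β≢)))))))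
      where
      d≰ : (d ≤ᵇ suc (𝔪 ∸ 1 ∸ i)) ≡ false
      d≰ = ≰⇒≤ᵇ-false (λ d≤ → d≰𝔪∸i (P.subst (d ≤_) (P.sym (m∸n≡1+[m∸1∸n] 𝔪 i i<𝔪)) d≤))
    ... | yes P.refl with d ≟ suc 𝔪 ∸ i
    ...   | yes d≡ = reflexive (P.trans
            (P.trans (if-false (∧-falseʳ (i <ᵇ 𝔪) (∧-falseˡ (suc i ≤ᵇ suc i) (≰⇒≤ᵇ-false d≰𝔪∸i))))
                     (if-true (∧-true (≡⇒≡ᵇ-true d≡) (≡⇒≡ᵇ-true {suc i} P.refl))))
            (P.sym (P.trans (if-false d≰)
              (if-true (∧-true (≡⇒≡ᵇ-true (∸-+-assoc 𝔪 1 i))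
                               (≡⇒≡ᵇ-true (P.trans d≡ (P.sym (m+2∸[1+n]≡1+m∸n 𝔪 i)))))))))
      where
      d≰ : (d ≤ᵇ suc (𝔪 ∸ 1 ∸ i)) ≡ false
      d≰ = ≰⇒≤ᵇ-false (λ d≤ → d≰𝔪∸i (P.subst (d ≤_) (P.sym (m∸n≡1+[m∸1∸n] 𝔪 i i<𝔪)) d≤))
    ...   | no d≢ = reflexive (P.trans
            (P.trans (if-false (∧-falseʳ (i <ᵇ 𝔪) (∧-falseˡ (suc i ≤ᵇ suc i) (≰⇒≤ᵇ-false d≰𝔪∸i))))
                     (if-false (∧-falseˡ (suc i ≡ᵇ suc i) (≢⇒≡ᵇ-false d≢))))
            (P.sym (P.trans (if-false d≰)
              (if-false (∧-falseʳ (𝔪 ∸ 1 ∸ i ≡ᵇ 𝔪 ∸ suc i)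
                          (≢⇒≡ᵇ-false (λ e → d≢ (P.trans e (m+2∸[1+n]≡1+m∸n 𝔪 i)))))))))
      where
      d≰ : (d ≤ᵇ suc (𝔪 ∸ 1 ∸ i)) ≡ false
      d≰ = ≰⇒≤ᵇ-false (λ d≤ → d≰𝔪∸i (P.subst (d ≤_) (P.sym (m∸n≡1+[m∸1∸n] 𝔪 i i<𝔪)) d≤))

    -- The (d,β)-block of C̄_i lists the coordinates of the vectors N^{𝔪-1-i} l_{d,t}
    -- along the basis vectors N^{𝔪-β} l_{𝔪+2-β,q}.
    C̄mat≈powCoords : ∀ P i d β t q → i < 𝔪 → β ≤ 𝔪 →
      C̄mat 𝔪 P i d β t q ≈ powCoords P (𝔪 ∸ 1 ∸ i) d t (𝔪 ∸ β) (𝔪 + 2 ∸ β) q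
    C̄mat≈powCoords P i d β t q i<𝔪 β≤𝔪 with d ≤? 𝔪 ∸ i
    ... | yes d≤ = C̄mat≈powCoords-relation P i d β t q i<𝔪 β≤𝔪 d≤
    ... | no d≰  = C̄mat≈powCoords-basisVector P i d β t q i<𝔪 β≤𝔪 d≰

    inSBlock : ℕ → ℕ → ℕ → Bool
    inSBlock i α β = (2 ≤ᵇ β) ∧ ((suc 𝔪 ∸ β) ≤ᵇ i) ∧ (i <ᵇ 𝔪) ∧ ((i + 2) ≤ᵇ α)

    inSBlock-sound : ∀ i α β → inSBlock i α β ≡ true → 2 ≤ β × suc 𝔪 ∸ β ≤ i × i + 2 ≤ α
    inSBlock-sound i α β e =
      let (e₁ , r₁) = ∧-true⁻¹ {2 ≤ᵇ β} e
          (e₂ , r₂) = ∧-true⁻¹ {(suc 𝔪 ∸ β) ≤ᵇ i} r₁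
          (_  , e₄) = ∧-true⁻¹ {i <ᵇ 𝔪} r₂
      in ≤ᵇ-true⇒≤ 2 β e₁ , ≤ᵇ-true⇒≤ (suc 𝔪 ∸ β) i e₂ , ≤ᵇ-true⇒≤ (i + 2) α e₄

    Cmat-cases : ∀ S i α β p q →
      (Cmat 𝔪 S i α β p q ≈ 0#) ⊎
      ((2 ≤ β × suc 𝔪 ∸ β ≤ i × i + 2 ≤ α) ⊎
       (α ≡ suc i × β ≡ suc 𝔪 ∸ i × p ≡ q × Cmat 𝔪 S i α β p q ≈ 1#))
    Cmat-cases S i α β p q with inSBlock i α β in inS
    ... | true = inj₂ (inj₁ (inSBlock-sound i α β inS))
    ... | false with (α ≡ᵇ suc i) ∧ (β ≡ᵇ suc 𝔪 ∸ i) in onI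
    ...   | false = inj₁ refl
    ...   | true with p ≡ᵇ q in p≡ᵇq
    ...     | false = inj₁ refl
    ...     | true  = inj₂ (inj₂ (≡ᵇ-true⇒≡ α (suc i) (proj₁ (∧-true⁻¹ onI)) ,
                                  ≡ᵇ-true⇒≡ β (suc 𝔪 ∸ i) (proj₂ (∧-true⁻¹ {α ≡ᵇ suc i} onI)) ,
                                  ≡ᵇ-true⇒≡ p q p≡ᵇq , refl))

    Cmat-identity : ∀ S i p → Cmat 𝔪 S i (suc i) (suc 𝔪 ∸ i) p p ≈ 1#
    Cmat-identity S i p = reflexive (P.trans
      (if-false (∧-falseʳ (2 ≤ᵇ suc 𝔪 ∸ i) (∧-falseʳ (suc 𝔪 ∸ (suc 𝔪 ∸ i) ≤ᵇ i) (∧-falseʳ (i <ᵇ 𝔪)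
        (≰⇒≤ᵇ-false (λ i+2≤ → <-irrefl P.refl (P.subst (_≤ suc i) (ℕ.+-comm i 2) i+2≤)))))))
      (P.trans (if-true (∧-true (≡⇒≡ᵇ-true {suc i} P.refl) (≡⇒≡ᵇ-true {suc 𝔪 ∸ i} P.refl)))
               (if-true (≡⇒≡ᵇ-true {p} P.refl))))
  module _ (N : Carrierᴹ → Carrierᴹ) (N-linear : IsLinear N) where

    open IsLinear N-linear renaming (cong to N-cong)

    N-0ᴹ : N 0ᴹ ≈ᴹ 0ᴹ
    N-0ᴹ = begin
      N 0ᴹ           ≈⟨ N-cong (≈ᴹ-sym (*ₗ-zeroˡ 0ᴹ)) ⟩
      N (0# *ₗ 0ᴹ)   ≈⟨ homogeneous 0# 0ᴹ ⟩
      0# *ₗ N 0ᴹ     ≈⟨ *ₗ-zeroˡ _ ⟩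
      0ᴹ             ∎
      where open ᴹ-Reasoning

    pow-cong : ∀ n {x y} → x ≈ᴹ y → pow N n x ≈ᴹ pow N n y
    pow-cong zero    x≈y = x≈y
    pow-cong (suc n) x≈y = N-cong (pow-cong n x≈y)

    pow-0ᴹ : ∀ n → pow N n 0ᴹ ≈ᴹ 0ᴹ
    pow-0ᴹ zero    = ≈ᴹ-refl
    pow-0ᴹ (suc n) = ≈ᴹ-trans (N-cong (pow-0ᴹ n)) N-0ᴹ

    pow-+ᴹ : ∀ n x y → pow N n (x +ᴹ y) ≈ᴹ pow N n x +ᴹ pow N n y
    pow-+ᴹ zero    x y = ≈ᴹ-refl
    pow-+ᴹ (suc n) x y = ≈ᴹ-trans (N-cong (pow-+ᴹ n x y)) (additive _ _)

    pow-*ₗ : ∀ n λ' x → pow N n (λ' *ₗ x) ≈ᴹ λ' *ₗ pow N n x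
    pow-*ₗ zero    λ' x = ≈ᴹ-refl
    pow-*ₗ (suc n) λ' x = ≈ᴹ-trans (N-cong (pow-*ₗ n λ' x)) (homogeneous λ' _)

    pow-+ : ∀ m n x → pow N (m + n) x ≡ pow N m (pow N n x)
    pow-+ zero    n x = P.refl
    pow-+ (suc m) n x = P.cong N (pow-+ m n x)

    pow-sumFromV : ∀ n a m f → pow N n (sumFromV a m f) ≈ᴹ sumFromV a m (λ i → pow N n (f i))
    pow-sumFromV n = 𝕍⇒𝕍.sumFrom-hom (pow N n) (pow-cong n) (pow-0ᴹ n) (pow-+ᴹ n)

    pow-nilpotent : ∀ {𝔪} → Nilpotent N 𝔪 → ∀ n x → 𝔪 ≤ n → pow N n x ≈ᴹ 0ᴹ
    pow-nilpotent {𝔪} nil n x 𝔪≤n = begin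
      pow N n x                     ≡⟨ P.cong (λ z → pow N z x) (P.sym (m∸n+n≡m 𝔪≤n)) ⟩
      pow N ((n ∸ 𝔪) + 𝔪) x         ≡⟨ pow-+ (n ∸ 𝔪) 𝔪 x ⟩
      pow N (n ∸ 𝔪) (pow N 𝔪 x)     ≈⟨ pow-cong (n ∸ 𝔪) (nil x) ⟩
      pow N (n ∸ 𝔪) 0ᴹ              ≈⟨ pow-0ᴹ (n ∸ 𝔪) ⟩
      0ᴹ                            ∎
      where open ᴹ-Reasoning

    module _ (𝔪 : ℕ) (k : ℕ → ℕ) (l : ℕ → ℕ → Carrierᴹ) where

      comb-*ₗ : ∀ u₀ λ' cf → comb N 𝔪 k l u₀ (λ α β γ → λ' *ᶠ cf α β γ) ≈ᴹ λ' *ₗ comb N 𝔪 k l u₀ cf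
      comb-*ₗ u₀ λ' cf = ≈ᴹ-sym (≈ᴹ-trans (*ₗ-sumFromV λ' u₀ (suc (𝔪 ∸ 1) ∸ u₀) _) (𝕍.Σ-cong u₀ (𝔪 ∸ 1) (λ α _ _ →
         ≈ᴹ-trans (*ₗ-sumFromV λ' (α + 2) (suc (suc 𝔪) ∸ (α + 2)) _) (𝕍.Σ-cong (α + 2) (suc 𝔪) (λ β _ _ →
         ≈ᴹ-trans (*ₗ-sumFromV λ' 1 (k β) _) (𝕍.Σ-cong 1 (k β) (λ γ _ _ → ≈ᴹ-sym (*ₗ-assoc _ _ _))))))))

      comb-sumFromK : ∀ u₀ a n (g : ℕ → ℕ → ℕ → ℕ → Carrier) →
        comb N 𝔪 k l u₀ (λ α β γ → sumFromK a n (λ x → g x α β γ)) ≈ᴹ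
        sumFromV a n (λ x → comb N 𝔪 k l u₀ (g x))
      comb-sumFromK u₀ a n g = begin
        comb N 𝔪 k l u₀ (λ α β γ → sumFromK a n (λ x → g x α β γ))
          ≈⟨ 𝕍.Σ-cong u₀ (𝔪 ∸ 1) (λ α _ _ → 𝕍.Σ-cong (α + 2) (suc 𝔪) (λ β _ _ →
               𝕍.Σ-cong 1 (k β) (λ γ _ _ → sumFromK-*ₗ a n _ _))) ⟩
        (ΣV[ u₀ ⋯ 𝔪 ∸ 1 ] λ α → ΣV[ α + 2 ⋯ suc 𝔪 ] λ β → ΣV[ 1 ⋯ k β ] λ γ →
            sumFromV a n (λ x → g x α β γ *ₗ pow N α (l β γ)))
          ≈⟨ 𝕍.Σ-cong u₀ (𝔪 ∸ 1) (λ α _ _ → 𝕍.Σ-cong (α + 2) (suc 𝔪) (λ β _ _ →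
               𝕍.sumFrom-comm 1 (k β) a n _)) ⟩
        (ΣV[ u₀ ⋯ 𝔪 ∸ 1 ] λ α → ΣV[ α + 2 ⋯ suc 𝔪 ] λ β → sumFromV a n λ x →
            ΣV[ 1 ⋯ k β ] λ γ → g x α β γ *ₗ pow N α (l β γ))
          ≈⟨ 𝕍.Σ-cong u₀ (𝔪 ∸ 1) (λ α _ _ → 𝕍.sumFrom-comm (α + 2) (suc (suc 𝔪) ∸ (α + 2)) a n _) ⟩
        (ΣV[ u₀ ⋯ 𝔪 ∸ 1 ] λ α → sumFromV a n λ x → ΣV[ α + 2 ⋯ suc 𝔪 ] λ β →
            ΣV[ 1 ⋯ k β ] λ γ → g x α β γ *ₗ pow N α (l β γ))
          ≈⟨ 𝕍.sumFrom-comm u₀ (suc (𝔪 ∸ 1) ∸ u₀) a n _ ⟩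
        sumFromV a n (λ x → comb N 𝔪 k l u₀ (g x))
          ∎
        where open ᴹ-Reasoning

      comb-powCoords-relation : ∀ P → IsPFamily N 𝔪 k l P →
        ∀ v w d t → v ≤ w → w ≤ 𝔪 ∸ 1 → d ∈[ 1 ⋯ suc 𝔪 ] → t ∈[ 1 ⋯ k d ] → d ≤ suc w →
        comb N 𝔪 k l v (powCoords 𝔪 P w d t) ≈ᴹ pow N w (l d t)
      comb-powCoords-relation P isP v w d t v≤w w≤ d∈ t∈ d≤1+w = begin
        comb N 𝔪 k l v (powCoords 𝔪 P w d t)
          ≈⟨ 𝕍.Σ-restrict v (𝔪 ∸ 1) w (𝔪 ∸ 1) v≤w (m≤n⇒m≤1+n w≤) ≤-refl _
              (λ z _ z≤ → λ { (inj₁ z<w) → 𝕍.Σ-ε (z + 2) (suc 𝔪) (λ y _ _ → 𝕍.Σ-ε 1 (k y) (λ s _ _ →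
                                 x≈0⇒x*y≈0 (reflexive (P.trans (if-true (≤⇒≤ᵇ-true d≤1+w))
                                                               (if-false (≰⇒≤ᵇ-false (<⇒≱ z<w)))))))
                            ; (inj₂ z>) → ⊥-elim (<⇒≱ z> z≤) }) ⟩
        (ΣV[ w ⋯ 𝔪 ∸ 1 ] λ z → ΣV[ z + 2 ⋯ suc 𝔪 ] λ y → ΣV[ 1 ⋯ k y ] λ s →
            powCoords 𝔪 P w d t z y s *ₗ pow N z (l y s))
          ≈⟨ 𝕍.Σ-cong w (𝔪 ∸ 1) (λ z w≤z _ → ≈ᴹ-trans (𝕍.Σ-cong (z + 2) (suc 𝔪) (λ y _ _ →
                ≈ᴹ-trans (𝕍.Σ-cong 1 (k y) (λ s _ _ →
                   ≈ᴹ-trans (*ₗ-congʳ (reflexive (P.trans (if-true (≤⇒≤ᵇ-true d≤1+w))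
                                                           (if-true (≤⇒≤ᵇ-true w≤z)))))
                            (-‿*ₗ _ _)))
                (≈ᴹ-sym (-ᴹ-sumFromV 1 (k y) _))))
                (≈ᴹ-sym (-ᴹ-sumFromV (z + 2) (suc (suc 𝔪) ∸ (z + 2)) _))) ⟩
        (ΣV[ w ⋯ 𝔪 ∸ 1 ] λ z → -ᴹ (ΣV[ z + 2 ⋯ suc 𝔪 ] λ y → ΣV[ 1 ⋯ k y ] λ s →
            P d w y z t s *ₗ pow N z (l y s)))
          ≈⟨ ≈ᴹ-sym (-ᴹ-sumFromV w (suc (𝔪 ∸ 1) ∸ w) _) ⟩
        -ᴹ (ΣV[ w ⋯ 𝔪 ∸ 1 ] λ z → ΣV[ z + 2 ⋯ suc 𝔪 ] λ y → ΣV[ 1 ⋯ k y ] λ s →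
            P d w y z t s *ₗ pow N z (l y s))
          ≈⟨ ≈ᴹ-sym (isP w d t (z≤n , w≤) d∈ t∈) ⟩
        pow N w (l d t)
          ∎
        where open ᴹ-Reasoning

      comb-powCoords-basisVector : ∀ P v w d t → v ≤ w → w ≤ 𝔪 ∸ 1 → d ≤ suc 𝔪 → t ∈[ 1 ⋯ k d ] →
        ¬ d ≤ suc w → comb N 𝔪 k l v (powCoords 𝔪 P w d t) ≈ᴹ pow N w (l d t)
      comb-powCoords-basisVector P v w d t v≤w w≤ d≤1+𝔪 t∈ d≰1+w = begin
        comb N 𝔪 k l v (powCoords 𝔪 P w d t)
          ≈⟨ 𝕍.Σ-single v (𝔪 ∸ 1) w v≤w w≤ _ (λ z _ _ z≢w → 𝕍.Σ-ε (z + 2) (suc 𝔪) (λ y _ _ →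
               𝕍.Σ-ε 1 (k y) (λ s _ _ → x≈0⇒x*y≈0 (reflexive (P.trans (if-false d≰)
                  (if-false (∧-falseˡ _ (≢⇒≡ᵇ-false (λ e → z≢w (P.sym e)))))))))) ⟩
        (ΣV[ w + 2 ⋯ suc 𝔪 ] λ y → ΣV[ 1 ⋯ k y ] λ s → powCoords 𝔪 P w d t w y s *ₗ pow N w (l y s))
          ≈⟨ 𝕍.Σ-single (w + 2) (suc 𝔪) d w+2≤d d≤1+𝔪 _ (λ y _ _ y≢d → 𝕍.Σ-ε 1 (k y) (λ s _ _ →
               x≈0⇒x*y≈0 (reflexive (P.trans (if-false d≰)
                  (if-false (∧-falseʳ (w ≡ᵇ w) (≢⇒≡ᵇ-false (λ e → y≢d (P.sym e))))))))) ⟩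
        (ΣV[ 1 ⋯ k d ] λ s → powCoords 𝔪 P w d t w d s *ₗ pow N w (l d s))
          ≈⟨ 𝕍.Σ-single 1 (k d) t (proj₁ t∈) (proj₂ t∈) _ (λ s _ _ s≢t → x≈0⇒x*y≈0 (reflexive
               (P.trans (if-false d≰) (P.trans (if-true on-diagonal)
                 (if-false (≢⇒≡ᵇ-false (λ e → s≢t (P.sym e)))))))) ⟩
        powCoords 𝔪 P w d t w d t *ₗ pow N w (l d t)
          ≈⟨ *ₗ-congʳ (reflexive (P.trans (if-false d≰) (P.trans (if-true on-diagonal)
               (if-true (≡⇒≡ᵇ-true {t} P.refl))))) ⟩
        1# *ₗ pow N w (l d t)
          ≈⟨ *ₗ-identityˡ _ ⟩
        pow N w (l d t)
          ∎
        where
        open ᴹ-Reasoning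
        d≰ : (d ≤ᵇ suc w) ≡ false
        d≰ = ≰⇒≤ᵇ-false d≰1+w
        on-diagonal : ((w ≡ᵇ w) ∧ (d ≡ᵇ d)) ≡ true
        on-diagonal = ∧-true (≡⇒≡ᵇ-true {w} P.refl) (≡⇒≡ᵇ-true {d} P.refl)
        w+2≤d : w + 2 ≤ d
        w+2≤d = P.subst (_≤ d) (ℕ.+-comm 2 w) (≰⇒> d≰1+w)

      comb-powCoords : ∀ P → IsPFamily N 𝔪 k l P →
        ∀ v w d t → v ≤ w → w ≤ 𝔪 ∸ 1 → d ∈[ 1 ⋯ suc 𝔪 ] → t ∈[ 1 ⋯ k d ] →
        comb N 𝔪 k l v (powCoords 𝔪 P w d t) ≈ᴹ pow N w (l d t)
      comb-powCoords P isP v w d t v≤w w≤ d∈ t∈ with d ≤? suc w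
      ... | yes d≤1+w = comb-powCoords-relation P isP v w d t v≤w w≤ d∈ t∈ d≤1+w
      ... | no d≰1+w  = comb-powCoords-basisVector P v w d t v≤w w≤ (proj₂ d∈) t∈ d≰1+w

      module _ (nil : Nilpotent N 𝔪) (1≤𝔪 : 1 ≤ 𝔪)
               (basis : ∀ u₀ → u₀ < 𝔪 → IsBasisOfImage N 𝔪 k l u₀)
               (S P : MatFamily) (isS : IsSFamily N 𝔪 k l S) (isP : IsPFamily N 𝔪 k l P) where

        module Annihilation (j : ℕ) (j<𝔪 : j < 𝔪) (α p : ℕ) (α≤ : α ≤ suc 𝔪)
                            (p∈ : p ∈[ 1 ⋯ k (𝔪 + 2 ∸ α) ]) where

          v : ℕ
          v = 𝔪 ∸ 1 ∸ j

          j≤𝔪∸1 : j ≤ 𝔪 ∸ 1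
          j≤𝔪∸1 = <⇒≤∸1 j<𝔪

          -- N^v applied to the (α,p)-entry of B(S)^t, truncated at degree b and with the formal variable
          -- acting as N, times the vector (l_{d,t})_{d,t}.
          columnImage : ℕ → Carrierᴹ
          columnImage b = ΣV[ 0 ⋯ b ] λ a → ΣV[ 1 ⋯ suc 𝔪 ] λ d → ΣV[ 1 ⋯ k d ] λ t →
                            Cmat 𝔪 S a d α t p *ₗ pow N (v + a) (l d t)

          columnImage≈0-inactive : ¬ (2 ≤ α × suc 𝔪 ∸ α ≤ j) → columnImage j ≈ᴹ 0ᴹ
          columnImage≈0-inactive inactive =
            𝕍.Σ-ε 0 j (λ a _ a≤j → 𝕍.Σ-ε 1 (suc 𝔪) (λ d _ _ → 𝕍.Σ-ε 1 (k d) (λ t _ _ →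
              x≈0⇒x*y≈0 (C≈0 a d t a≤j))))
            where
            C≈0 : ∀ a d t → a ≤ j → Cmat 𝔪 S a d α t p ≈ 0#
            C≈0 a d t a≤j with Cmat-cases 𝔪 S a d α t p
            ... | inj₁ C≈0′ = C≈0′
            ... | inj₂ (inj₁ (2≤α , u≤a , _)) = ⊥-elim (inactive (2≤α , ≤-trans u≤a a≤j))
            ... | inj₂ (inj₂ (_ , α≡ , _ , _)) = ⊥-elim (inactive (2≤α , u≤j))
              where
              a+2≤ : a + 2 ≤ suc 𝔪
              a+2≤ = P.subst (_≤ suc 𝔪) (ℕ.+-comm 2 a) (s≤s (≤-trans (s≤s a≤j) j<𝔪))
              2≤α : 2 ≤ α
              2≤α = P.subst (2 ≤_) (P.sym α≡) (m+n≤o⇒m≤o∸n 2 (P.subst (_≤ suc 𝔪) (ℕ.+-comm a 2) a+2≤))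
              u≤j : suc 𝔪 ∸ α ≤ j
              u≤j = P.subst (_≤ j) (P.sym (P.trans (P.cong (suc 𝔪 ∸_) α≡)
                      (m∸[m∸n]≡n (≤-trans (m≤m+n a 2) a+2≤)))) a≤j

          -- Terms of degree a > j vanish because v + a ≥ 𝔪.
          columnImage-extend : columnImage j ≈ᴹ columnImage (𝔪 ∸ 1)
          columnImage-extend = ≈ᴹ-sym (𝕍.Σ-restrict 0 (𝔪 ∸ 1) 0 j z≤n z≤n j≤𝔪∸1 _ beyond-j)
            where
            beyond-j : ∀ a → 0 ≤ a → a ≤ 𝔪 ∸ 1 → (a < 0 ⊎ j < a) → _
            beyond-j a _ _ (inj₂ j<a) = 𝕍.Σ-ε 1 (suc 𝔪) (λ d _ _ → 𝕍.Σ-ε 1 (k d) (λ t _ _ →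
              y≈0⇒x*y≈0 (pow-nilpotent nil (v + a) (l d t)
                (P.subst (_≤ v + a) ([m∸1∸n]+[1+n]≡m 𝔪 j j<𝔪) (+-monoʳ-≤ v j<a)))))

          -- The column α of B(S) is active: its identity entry sits in degree u = 𝔪+1-α ≤ j, and
          -- its S-entries are the coefficients of the relation expressing N^u l_{u+1,p}.
          module Active (2≤α : 2 ≤ α) (u≤j : suc 𝔪 ∸ α ≤ j) where

            u : ℕ
            u = suc 𝔪 ∸ α

            u≤𝔪∸1 : u ≤ 𝔪 ∸ 1
            u≤𝔪∸1 = ≤-trans u≤j j≤𝔪∸1

            1+u≤𝔪 : suc u ≤ 𝔪
            1+u≤𝔪 = ≤-trans (s≤s u≤j) j<𝔪

            p≤ : p ≤ k (suc u)
            p≤ = P.subst (λ z → p ≤ k z) (m+2∸n≡1+[1+m∸n] 𝔪 α α≤) (proj₂ p∈)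

            α≡1+𝔪∸u : α ≡ suc 𝔪 ∸ u
            α≡1+𝔪∸u = P.sym (m∸[m∸n]≡n α≤)

            Ssum : Carrierᴹ
            Ssum = ΣV[ u ⋯ 𝔪 ∸ 1 ] λ z → ΣV[ z + 2 ⋯ suc 𝔪 ] λ y → ΣV[ 1 ⋯ k y ] λ s →
                     S (suc u) u y z p s *ₗ pow N z (l y s)

            identityPart SPart : ℕ → ℕ → ℕ → Carrier
            identityPart a d t = if (d ≡ᵇ suc a) ∧ (α ≡ᵇ suc 𝔪 ∸ a) then δ t p else 0#
            SPart a d t = if inSBlock 𝔪 a d α then S (suc u) u d a p t else 0#

            Cmat≈identityPart+SPart : ∀ a d t → Cmat 𝔪 S a d α t p ≈ identityPart a d t +ᶠ SPart a d t
            Cmat≈identityPart+SPart a d t with inSBlock 𝔪 a d α in inS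
            ... | true = trans (reflexive (P.cong (λ U → S U u d a p t) (m+2∸n≡1+[1+m∸n] 𝔪 α α≤)))
                           (trans (sym (+-identityˡ _))
                             (+-congʳ (reflexive (P.sym (if-false (∧-falseˡ (α ≡ᵇ suc 𝔪 ∸ a)
                               (≢⇒≡ᵇ-false d≢1+a)))))))
              where
              d≢1+a : d ≢ suc a
              d≢1+a d≡ = <-irrefl P.refl (P.subst (suc (suc a) ≤_) d≡
                           (P.subst (_≤ d) (ℕ.+-comm a 2) (proj₂ (proj₂ (inSBlock-sound 𝔪 a d α inS)))))
            ... | false = sym (+-identityʳ _)

            identityTerms STerms : Carrierᴹ
            identityTerms = ΣV[ 0 ⋯ 𝔪 ∸ 1 ] λ a → ΣV[ 1 ⋯ suc 𝔪 ] λ d → ΣV[ 1 ⋯ k d ] λ t →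
                              identityPart a d t *ₗ pow N (v + a) (l d t)
            STerms = ΣV[ 0 ⋯ 𝔪 ∸ 1 ] λ a → ΣV[ 1 ⋯ suc 𝔪 ] λ d → ΣV[ 1 ⋯ k d ] λ t →
                       SPart a d t *ₗ pow N (v + a) (l d t)

            columnImage-split : columnImage (𝔪 ∸ 1) ≈ᴹ identityTerms +ᴹ STerms
            columnImage-split = ≈ᴹ-trans
              (𝕍.sumFrom³-cong 0 (suc (𝔪 ∸ 1)) (λ _ → 1) (λ _ → suc 𝔪) (λ _ _ → 1) (λ _ d → k d)
                (λ a d t → ≈ᴹ-trans (*ₗ-congʳ (Cmat≈identityPart+SPart a d t)) (*ₗ-distribʳ _ _ _)))
              (𝕍.sumFrom³-distrib 0 (suc (𝔪 ∸ 1)) (λ _ → 1) (λ _ → suc 𝔪) (λ _ _ → 1) (λ _ d → k d) _ _)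

            identityTerms≈ : identityTerms ≈ᴹ pow N (v + u) (l (suc u) p)
            identityTerms≈ = begin
              identityTerms
                ≈⟨ 𝕍.Σ-single 0 (𝔪 ∸ 1) u z≤n u≤𝔪∸1 _ (λ a _ a≤ a≢u → 𝕍.Σ-ε 1 (suc 𝔪) (λ d _ _ →
                     𝕍.Σ-ε 1 (k d) (λ t _ _ → x≈0⇒x*y≈0 (reflexive (if-false (∧-falseʳ (d ≡ᵇ suc a)
                       (≢⇒≡ᵇ-false (λ α≡ → a≢u (P.sym (u≡ a≤ α≡)))))))))) ⟩
              (ΣV[ 1 ⋯ suc 𝔪 ] λ d → ΣV[ 1 ⋯ k d ] λ t → identityPart u d t *ₗ pow N (v + u) (l d t))
                ≈⟨ 𝕍.Σ-single 1 (suc 𝔪) (suc u) (s≤s z≤n) (m≤n⇒m≤1+n 1+u≤𝔪) _ (λ d _ _ d≢ →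
                     𝕍.Σ-ε 1 (k d) (λ t _ _ → x≈0⇒x*y≈0 (reflexive (if-false (∧-falseˡ (α ≡ᵇ suc 𝔪 ∸ u)
                       (≢⇒≡ᵇ-false d≢)))))) ⟩
              (ΣV[ 1 ⋯ k (suc u) ] λ t → identityPart u (suc u) t *ₗ pow N (v + u) (l (suc u) t))
                ≈⟨ 𝕍.Σ-single 1 (k (suc u)) p (proj₁ p∈) p≤ _ (λ t _ _ t≢p → x≈0⇒x*y≈0
                     (reflexive (P.trans (if-true on-identity) (if-false (≢⇒≡ᵇ-false t≢p))))) ⟩
              identityPart u (suc u) p *ₗ pow N (v + u) (l (suc u) p)
                ≈⟨ *ₗ-congʳ (reflexive (P.trans (if-true on-identity) (if-true (≡⇒≡ᵇ-true {p} P.refl)))) ⟩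
              1# *ₗ pow N (v + u) (l (suc u) p)
                ≈⟨ *ₗ-identityˡ _ ⟩
              pow N (v + u) (l (suc u) p)
                ∎
              where
              open ᴹ-Reasoning
              on-identity : ((suc u ≡ᵇ suc u) ∧ (α ≡ᵇ suc 𝔪 ∸ u)) ≡ true
              on-identity = ∧-true (≡⇒≡ᵇ-true {suc u} P.refl) (≡⇒≡ᵇ-true α≡1+𝔪∸u)
              u≡ : ∀ {a} → a ≤ 𝔪 ∸ 1 → α ≡ suc 𝔪 ∸ a → u ≡ a
              u≡ a≤ α≡ = P.trans (P.cong (suc 𝔪 ∸_) α≡)
                           (m∸[m∸n]≡n (≤-trans a≤ (≤-trans (m∸n≤m 𝔪 1) (n≤1+n 𝔪))))

            STerms≈ : STerms ≈ᴹ pow N v Ssum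
            STerms≈ = begin
              STerms
                ≈⟨ 𝕍.Σ-restrict 0 (𝔪 ∸ 1) u (𝔪 ∸ 1) z≤n (m≤n⇒m≤1+n u≤𝔪∸1) ≤-refl _ below-u ⟩
              (ΣV[ u ⋯ 𝔪 ∸ 1 ] λ a → ΣV[ 1 ⋯ suc 𝔪 ] λ d → ΣV[ 1 ⋯ k d ] λ t →
                  SPart a d t *ₗ pow N (v + a) (l d t))
                ≈⟨ 𝕍.Σ-cong u (𝔪 ∸ 1) (λ a u≤a a≤ → ≈ᴹ-trans
                     (𝕍.Σ-restrict 1 (suc 𝔪) (a + 2) (suc 𝔪) (≤-trans (s≤s z≤n) (m≤n+m 2 a))
                        (P.subst (_≤ suc (suc 𝔪)) (ℕ.+-comm 2 a) (s≤s (s≤s (≤-trans a≤ (m∸n≤m 𝔪 1)))))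
                        ≤-refl _ (below-a+2 a))
                     (𝕍.Σ-cong (a + 2) (suc 𝔪) (λ d a+2≤d _ → 𝕍.Σ-cong 1 (k d) (λ t _ _ →
                        *ₗ-congʳ (reflexive (if-true (∧-true (≤⇒≤ᵇ-true 2≤α) (∧-true (≤⇒≤ᵇ-true u≤a)
                          (∧-true (<⇒<ᵇ-true (≤∸1⇒< 1≤𝔪 a≤)) (≤⇒≤ᵇ-true a+2≤d)))))))))) ⟩
              (ΣV[ u ⋯ 𝔪 ∸ 1 ] λ a → ΣV[ a + 2 ⋯ suc 𝔪 ] λ d → ΣV[ 1 ⋯ k d ] λ t →
                  S (suc u) u d a p t *ₗ pow N (v + a) (l d t))
                ≈⟨ ≈ᴹ-sym (pow-sumFromV³ v) ⟩
              pow N v Ssum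
                ∎
              where
              open ᴹ-Reasoning
              below-u : ∀ a → 0 ≤ a → a ≤ 𝔪 ∸ 1 → (a < u ⊎ 𝔪 ∸ 1 < a) → _
              below-u a _ _ (inj₁ a<u) = 𝕍.Σ-ε 1 (suc 𝔪) (λ d _ _ → 𝕍.Σ-ε 1 (k d) (λ t _ _ →
                x≈0⇒x*y≈0 (reflexive (if-false (∧-falseʳ (2 ≤ᵇ α)
                  (∧-falseˡ ((a <ᵇ 𝔪) ∧ ((a + 2) ≤ᵇ d)) (≰⇒≤ᵇ-false (<⇒≱ a<u))))))))
              below-u a _ a≤ (inj₂ a>) = ⊥-elim (<⇒≱ a> a≤)
              below-a+2 : ∀ a d → 1 ≤ d → d ≤ suc 𝔪 → (d < a + 2 ⊎ suc 𝔪 < d) → _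
              below-a+2 a d _ _ (inj₁ d<) = 𝕍.Σ-ε 1 (k d) (λ t _ _ →
                x≈0⇒x*y≈0 (reflexive (if-false (∧-falseʳ (2 ≤ᵇ α) (∧-falseʳ (u ≤ᵇ a) (∧-falseʳ (a <ᵇ 𝔪)
                  (≰⇒≤ᵇ-false (<⇒≱ d<))))))))
              below-a+2 a d _ d≤ (inj₂ d>) = ⊥-elim (<⇒≱ d> d≤)
              pow-sumFromV³ : ∀ v → pow N v Ssum ≈ᴹ
                (ΣV[ u ⋯ 𝔪 ∸ 1 ] λ a → ΣV[ a + 2 ⋯ suc 𝔪 ] λ d → ΣV[ 1 ⋯ k d ] λ t →
                   S (suc u) u d a p t *ₗ pow N (v + a) (l d t))
              pow-sumFromV³ v = ≈ᴹ-trans (pow-sumFromV v u (suc (𝔪 ∸ 1) ∸ u) _) (𝕍.Σ-cong u (𝔪 ∸ 1) (λ z _ _ →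
                ≈ᴹ-trans (pow-sumFromV v (z + 2) (suc (suc 𝔪) ∸ (z + 2)) _) (𝕍.Σ-cong (z + 2) (suc 𝔪) (λ y _ _ →
                  ≈ᴹ-trans (pow-sumFromV v 1 (k y) _) (𝕍.Σ-cong 1 (k y) (λ s _ _ →
                    ≈ᴹ-trans (pow-*ₗ v _ _) (*ₗ-congˡ (≈ᴹ-reflexive (P.sym (pow-+ v z (l y s)))))))))))

            -- The relation defining S: N^u l_{u+1,p} + Ssum = 0, hence its image under N^v vanishes.
            columnImage≈0 : columnImage j ≈ᴹ 0ᴹ
            columnImage≈0 = begin
              columnImage j                                     ≈⟨ columnImage-extend ⟩
              columnImage (𝔪 ∸ 1)                               ≈⟨ columnImage-split ⟩
              identityTerms +ᴹ STerms                           ≈⟨ +ᴹ-cong identityTerms≈ STerms≈ ⟩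
              pow N (v + u) (l (suc u) p) +ᴹ pow N v Ssum
                ≡⟨ P.cong (_+ᴹ pow N v Ssum) (pow-+ v u _) ⟩
              pow N v (pow N u (l (suc u) p)) +ᴹ pow N v Ssum   ≈⟨ ≈ᴹ-sym (pow-+ᴹ v _ _) ⟩
              pow N v (pow N u (l (suc u) p) +ᴹ Ssum)
                ≈⟨ pow-cong v (+ᴹ-congʳ (isS (suc u) p (s≤s z≤n , 1+u≤𝔪) (proj₁ p∈ , p≤))) ⟩
              pow N v (-ᴹ Ssum +ᴹ Ssum)                         ≈⟨ pow-cong v (-ᴹ‿inverseˡ Ssum) ⟩
              pow N v 0ᴹ                                        ≈⟨ pow-0ᴹ v ⟩
              0ᴹ                                                ∎
              where open ᴹ-Reasoning

          columnImage≈0 : columnImage j ≈ᴹ 0ᴹ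
          columnImage≈0 with 2 ≤? α | suc 𝔪 ∸ α ≤? j
          ... | yes 2≤α | yes u≤j = Active.columnImage≈0 2≤α u≤j
          ... | no 2≰α  | _       = columnImage≈0-inactive (λ (2≤α , _) → 2≰α 2≤α)
          ... | yes _   | no u≰j  = columnImage≈0-inactive (λ (_ , u≤j) → u≰j u≤j)

          coords : ℕ → ℕ → ℕ → Carrier
          coords z y s = ΣK[ 0 ⋯ j ] λ a → ΣK[ 1 ⋯ suc 𝔪 ] λ d → ΣK[ 1 ⋯ k d ] λ t →
                           Cmat 𝔪 S a d α t p *ᶠ powCoords 𝔪 P (v + a) d t z y s

          comb-coords≈0 : comb N 𝔪 k l v coords ≈ᴹ 0ᴹ
          comb-coords≈0 = begin
            comb N 𝔪 k l v coords
              ≈⟨ comb-sumFromK v 0 (suc j) _ ⟩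
            sumFromV 0 (suc j) (λ a → comb N 𝔪 k l v (λ z y s →
              ΣK[ 1 ⋯ suc 𝔪 ] λ d → ΣK[ 1 ⋯ k d ] λ t → Cmat 𝔪 S a d α t p *ᶠ powCoords 𝔪 P (v + a) d t z y s))
              ≈⟨ 𝕍.Σ-cong 0 j (λ a _ a≤j → ≈ᴹ-trans (comb-sumFromK v 1 (suc 𝔪) _)
                   (𝕍.Σ-cong 1 (suc 𝔪) (λ d 1≤d d≤ → ≈ᴹ-trans (comb-sumFromK v 1 (k d) _)
                     (𝕍.Σ-cong 1 (k d) (λ t 1≤t t≤ → ≈ᴹ-trans (comb-*ₗ v _ _)
                       (*ₗ-congˡ (comb-powCoords P isP v (v + a) d t (m≤m+n v a)
                          (v+a≤𝔪∸1 a a≤j) (1≤d , d≤) (1≤t , t≤)))))))) ⟩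
            columnImage j
              ≈⟨ columnImage≈0 ⟩
            0ᴹ
              ∎
            where
            open ᴹ-Reasoning
            v+a≤𝔪∸1 : ∀ a → a ≤ j → v + a ≤ 𝔪 ∸ 1
            v+a≤𝔪∸1 a a≤j = P.subst (v + a ≤_) (m∸n+n≡m j≤𝔪∸1) (+-monoʳ-≤ v a≤j)

          coords≈0 : ∀ β q → β ∈[ 1 ⋯ 𝔪 ] → q ∈[ 1 ⋯ k (𝔪 + 2 ∸ β) ] →
                     coords (𝔪 ∸ β) (𝔪 + 2 ∸ β) q ≈ 0#
          coords≈0 β q (1≤β , β≤𝔪) q∈ with 𝔪 ∸ β <? v
          ... | yes z<v = 𝕂.Σ-ε 0 j (λ a _ _ → 𝕂.Σ-ε 1 (suc 𝔪) (λ d _ _ → 𝕂.Σ-ε 1 (k d) (λ t _ _ →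
                  trans (*-congˡ (powCoords-below 𝔪 P (v + a) d t _ _ q (≤-trans z<v (m≤m+n v a))))
                        (zeroʳ _))))
          ... | no z≮v = proj₁ (basis v (≤∸1⇒< 1≤𝔪 (m∸n≤m (𝔪 ∸ 1) j))) coords comb-coords≈0
                  (𝔪 ∸ β) (𝔪 + 2 ∸ β) q (≮⇒≥ z≮v , ∸-monoʳ-≤ 𝔪 1≤β) (z+2≤y , y≤1+𝔪) q∈
            where
            z+2≤y : (𝔪 ∸ β) + 2 ≤ 𝔪 + 2 ∸ β
            z+2≤y = P.subst ((𝔪 ∸ β) + 2 ≤_) (P.sym (+-∸-comm 2 β≤𝔪)) ≤-refl
            y≤1+𝔪 : 𝔪 + 2 ∸ β ≤ suc 𝔪
            y≤1+𝔪 = P.subst (𝔪 + 2 ∸ β ≤_) (P.cong (_∸ 1) (ℕ.+-comm 𝔪 2)) (∸-monoʳ-≤ (𝔪 + 2) 1≤β)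

        prodCoeff-C̄mat≈0 : ∀ j α β p q → j < 𝔪 → α ∈[ 1 ⋯ suc 𝔪 ] → β ∈[ 1 ⋯ suc 𝔪 ] →
          p ∈[ 1 ⋯ k (𝔪 + 2 ∸ α) ] → q ∈[ 1 ⋯ k (𝔪 + 2 ∸ β) ] →
          prodCoeff 𝔪 k S (C̄mat 𝔪 P) j α β p q ≈ 0#
        prodCoeff-C̄mat≈0 j α β p q j<𝔪 (_ , α≤) (1≤β , β≤) p∈ q∈ with β ≤? 𝔪
        ... | yes β≤𝔪 = trans (𝕂.Σ-cong 0 j (λ a _ a≤j → 𝕂.Σ-cong 1 (suc 𝔪) (λ d _ _ → 𝕂.Σ-cong 1 (k d)
                          (λ t _ _ → *-congˡ (trans (C̄mat≈powCoords 𝔪 P (j ∸ a) d β t q (j∸a<𝔪 a) β≤𝔪)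
                            (reflexive (P.cong (λ w → powCoords 𝔪 P w d t (𝔪 ∸ β) (𝔪 + 2 ∸ β) q)
                               (m∸1∸[n∸o]≡[m∸1∸n]+o 𝔪 j a j<𝔪 a≤j))))))))
                        (Annihilation.coords≈0 j j<𝔪 α p α≤ p∈ β q (1≤β , β≤𝔪) q∈)
          where
          j∸a<𝔪 : ∀ a → j ∸ a < 𝔪
          j∸a<𝔪 a = ≤-trans (s≤s (m∸n≤m j a)) j<𝔪
        ... | no β≰𝔪 = 𝕂.Σ-ε 0 j (λ a _ _ → 𝕂.Σ-ε 1 (suc 𝔪) (λ d _ _ → 𝕂.Σ-ε 1 (k d)
                          (λ t _ _ → trans (*-congˡ (C̄≈0 a d t)) (zeroʳ _))))
          where
          C̄≈0 : ∀ a d t → C̄mat 𝔪 P (j ∸ a) d β t q ≈ 0#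
          C̄≈0 a d t = reflexive (P.trans
            (if-false (∧-falseʳ ((j ∸ a) <ᵇ 𝔪) (∧-falseʳ (d ≤ᵇ 𝔪 ∸ (j ∸ a))
              (≰⇒≤ᵇ-false (λ β≤ → β≰𝔪 (≤-trans β≤ j∸a<𝔪))))))
            (if-false (∧-falseʳ (d ≡ᵇ suc 𝔪 ∸ (j ∸ a))
              (≢⇒≡ᵇ-false (λ β≡ → β≰𝔪 (P.subst (_≤ 𝔪) (P.sym β≡) j∸a<𝔪))))))
            where
            j∸a<𝔪 : suc (j ∸ a) ≤ 𝔪
            j∸a<𝔪 = ≤-trans (s≤s (m∸n≤m j a)) j<𝔪

        module Uniqueness (X : ℕ → BlockMat)
          (X-annihilated : ∀ j α β p q → j < 𝔪 → α ∈[ 1 ⋯ suc 𝔪 ] → β ∈[ 1 ⋯ suc 𝔪 ] →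
            p ∈[ 1 ⋯ k (𝔪 + 2 ∸ α) ] → q ∈[ 1 ⋯ k (𝔪 + 2 ∸ β) ] →
            prodCoeff 𝔪 k S X j α β p q ≈ 0#) where

          open import Algebra.Properties.Group +-group using (x∙y⁻¹≈ε⇒x≈y; x≈y⇒x∙y⁻¹≈ε)

          Y : ℕ → BlockMat
          Y = C̄mat 𝔪 P

          Δ : ℕ → BlockMat
          Δ i α β p q = X i α β p q +ᶠ - Y i α β p q

          prodCoeff-X≈Y+Δ : ∀ j α β p q →
            prodCoeff 𝔪 k S X j α β p q ≈ prodCoeff 𝔪 k S Y j α β p q +ᶠ prodCoeff 𝔪 k S Δ j α β p q
          prodCoeff-X≈Y+Δ j α β p q =
            trans (𝕂.sumFrom³-cong 0 (suc j) (λ _ → 1) (λ _ → suc 𝔪) (λ _ _ → 1) (λ _ d → k d)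
                     (λ a d t → trans (*-congˡ (x≈y+[x-y] _ _)) (distribˡ _ _ _)))
                  (𝕂.sumFrom³-distrib 0 (suc j) (λ _ → 1) (λ _ → suc 𝔪) (λ _ _ → 1) (λ _ d → k d) _ _)
            where
            x≈y+[x-y] : ∀ x y → x ≈ y +ᶠ (x +ᶠ - y)
            x≈y+[x-y] x y = sym (begin
              y +ᶠ (x +ᶠ - y)  ≈⟨ +-congˡ (+-comm x (- y)) ⟩
              y +ᶠ (- y +ᶠ x)  ≈⟨ sym (+-assoc y (- y) x) ⟩
              (y +ᶠ - y) +ᶠ x  ≈⟨ +-congʳ (-‿inverseʳ y) ⟩
              0# +ᶠ x          ≈⟨ +-identityˡ x ⟩
              x                ∎)
              where open ᶠ-Reasoning

          -- In the coefficient of N^{i+a} of B(S)^t Δ at block (𝔪+1-a, β), the block (a+1, β) of Δ_i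
          -- meets the identity entry of C_a; every other term involves Δ_{i'} with i' < i, or Δ_i
          -- in a row block below a+1.
          module FreeEntry (i a β p q : ℕ) (i<𝔪 : i < 𝔪) (1+a≤𝔪∸i : suc a ≤ 𝔪 ∸ i)
            (β∈ : β ∈[ 1 ⋯ suc 𝔪 ]) (p∈ : p ∈[ 1 ⋯ k (suc a) ]) (q∈ : q ∈[ 1 ⋯ k (𝔪 + 2 ∸ β) ])
            (earlier : ∀ i' d t → i' ≤ i → (i' < i ⊎ suc a < d) → d ∈[ 1 ⋯ suc 𝔪 ] → t ∈[ 1 ⋯ k d ] →
                       X i' d β t q ≈ Y i' d β t q) where

            j α : ℕ
            j = i + a
            α = suc 𝔪 ∸ a

            j<𝔪 : j < 𝔪
            j<𝔪 = P.subst (_< 𝔪) (ℕ.+-comm a i) (P.subst (suc a + i ≤_) (m∸n+n≡m (<⇒≤ i<𝔪)) (+-monoˡ-≤ i 1+a≤𝔪∸i))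

            a≤j : a ≤ j
            a≤j = m≤n+m a i

            a≤𝔪 : a ≤ 𝔪
            a≤𝔪 = ≤-trans a≤j (<⇒≤ j<𝔪)

            1+𝔪∸α≡a : suc 𝔪 ∸ α ≡ a
            1+𝔪∸α≡a = m∸[m∸n]≡n (m≤n⇒m≤1+n a≤𝔪)

            α∈ : α ∈[ 1 ⋯ suc 𝔪 ]
            α∈ = P.subst (1 ≤_) (P.sym (+-∸-assoc 1 a≤𝔪)) (s≤s z≤n) , m∸n≤m (suc 𝔪) a

            p∈′ : p ∈[ 1 ⋯ k (𝔪 + 2 ∸ α) ]
            p∈′ = proj₁ p∈ , P.subst (λ z → p ≤ k z)
                    (P.sym (P.trans (m+2∸n≡1+[1+m∸n] 𝔪 α (proj₂ α∈)) (P.cong suc 1+𝔪∸α≡a))) (proj₂ p∈)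

            term≈0 : ∀ a′ d t → a′ ≤ j → d ∈[ 1 ⋯ suc 𝔪 ] → t ∈[ 1 ⋯ k d ] → ¬ (a′ ≡ a × d ≡ suc a × t ≡ p) →
                     Cmat 𝔪 S a′ d α t p *ᶠ Δ (j ∸ a′) d β t q ≈ 0#
            term≈0 a′ d t a′≤j d∈ t∈ not-identity with Cmat-cases 𝔪 S a′ d α t p
            ... | inj₁ C≈0 = trans (*-congʳ C≈0) (zeroˡ _)
            ... | inj₂ (inj₂ (d≡ , α≡ , t≡ , _)) = ⊥-elim (not-identity (a′≡a , P.trans d≡ (P.cong suc a′≡a) , t≡))
              where
              a′≡a : a′ ≡ a
              a′≡a = P.trans (P.sym (m∸[m∸n]≡n (≤-trans a′≤j (≤-trans (<⇒≤ j<𝔪) (n≤1+n 𝔪)))))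
                       (P.trans (P.cong (suc 𝔪 ∸_) (P.sym α≡)) 1+𝔪∸α≡a)
            ... | inj₂ (inj₁ (_ , u≤a′ , a′+2≤d)) =
              trans (*-congˡ (x≈y⇒x∙y⁻¹≈ε (earlier (j ∸ a′) d t ([m+n]∸o≤m i a a′ a≤a′) earlier-entry d∈ t∈)))
                    (zeroʳ _)
              where
              a≤a′ : a ≤ a′
              a≤a′ = P.subst (_≤ a′) 1+𝔪∸α≡a u≤a′
              earlier-entry : j ∸ a′ < i ⊎ suc a < d
              earlier-entry with m≤n⇒m<n∨m≡n a≤a′
              ... | inj₁ a<a′ = inj₁ ([m+n]∸o<m i a a′ a<a′ a′≤j)
              ... | inj₂ P.refl = inj₂ (P.subst (_≤ d) (ℕ.+-comm a 2) a′+2≤d)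

            prodCoeff-Δ-collapse : prodCoeff 𝔪 k S Δ j α β p q ≈ Δ i (suc a) β p q
            prodCoeff-Δ-collapse = begin
              prodCoeff 𝔪 k S Δ j α β p q
                ≈⟨ 𝕂.Σ-single 0 j a z≤n a≤j _ (λ a′ _ a′≤j a′≢a → 𝕂.Σ-ε 1 (suc 𝔪) (λ d 1≤d d≤ →
                     𝕂.Σ-ε 1 (k d) (λ t 1≤t t≤ → term≈0 a′ d t a′≤j (1≤d , d≤) (1≤t , t≤) (a′≢a ∘ proj₁)))) ⟩
              transMul 𝔪 k (Cmat 𝔪 S a) (Δ (j ∸ a)) α β p q
                ≈⟨ 𝕂.Σ-single 1 (suc 𝔪) (suc a) (s≤s z≤n) (s≤s a≤𝔪) _ (λ d 1≤d d≤ d≢ →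
                     𝕂.Σ-ε 1 (k d) (λ t 1≤t t≤ → term≈0 a d t a≤j (1≤d , d≤) (1≤t , t≤) (d≢ ∘ proj₁ ∘ proj₂))) ⟩
              (ΣK[ 1 ⋯ k (suc a) ] λ t → Cmat 𝔪 S a (suc a) α t p *ᶠ Δ (j ∸ a) (suc a) β t q)
                ≈⟨ 𝕂.Σ-single 1 (k (suc a)) p (proj₁ p∈) (proj₂ p∈) _ (λ t 1≤t t≤ t≢p →
                     term≈0 a (suc a) t a≤j (s≤s z≤n , s≤s a≤𝔪) (1≤t , t≤) (t≢p ∘ proj₂ ∘ proj₂)) ⟩
              Cmat 𝔪 S a (suc a) α p p *ᶠ Δ (j ∸ a) (suc a) β p q
                ≈⟨ *-congʳ (Cmat-identity 𝔪 S a p) ⟩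
              1# *ᶠ Δ (j ∸ a) (suc a) β p q
                ≈⟨ *-identityˡ _ ⟩
              Δ (j ∸ a) (suc a) β p q
                ≡⟨ P.cong (λ i′ → Δ i′ (suc a) β p q) (m+n∸n≡m i a) ⟩
              Δ i (suc a) β p q
                ∎
              where open ᶠ-Reasoning

            agrees : X i (suc a) β p q ≈ Y i (suc a) β p q
            agrees = x∙y⁻¹≈ε⇒x≈y _ _ (begin
              Δ i (suc a) β p q                                              ≈⟨ sym prodCoeff-Δ-collapse ⟩
              prodCoeff 𝔪 k S Δ j α β p q                                    ≈⟨ sym (+-identityˡ _) ⟩
              0# +ᶠ prodCoeff 𝔪 k S Δ j α β p q                              ≈⟨ +-congʳ (sym Y-annihilated) ⟩
              prodCoeff 𝔪 k S Y j α β p q +ᶠ prodCoeff 𝔪 k S Δ j α β p q    ≈⟨ sym (prodCoeff-X≈Y+Δ j α β p q) ⟩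
              prodCoeff 𝔪 k S X j α β p q                                    ≈⟨ X-annihilated j α β p q j<𝔪 α∈ β∈ p∈′ q∈ ⟩
              0#                                                             ∎)
              where
              open ᶠ-Reasoning
              Y-annihilated : prodCoeff 𝔪 k S Y j α β p q ≈ 0#
              Y-annihilated = prodCoeff-C̄mat≈0 j α β p q j<𝔪 α∈ β∈ p∈′ q∈

          Agrees : ℕ → ℕ → Set ℓ
          Agrees i α = ∀ β p q → α ∈[ 1 ⋯ suc 𝔪 ] → β ∈[ 1 ⋯ suc 𝔪 ] →
                       p ∈[ 1 ⋯ k α ] → q ∈[ 1 ⋯ k (𝔪 + 2 ∸ β) ] → X i α β p q ≈ Y i α β p q

          module _ (X-fixed : ∀ i α β p q → i ≤ 𝔪 → α ∈[ 1 ⋯ suc 𝔪 ] → β ∈[ 1 ⋯ suc 𝔪 ] →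
                     p ∈[ 1 ⋯ k α ] → q ∈[ 1 ⋯ k (𝔪 + 2 ∸ β) ] →
                     ¬ FreeBlock 𝔪 i α β → X i α β p q ≈ Y i α β p q) where

            agrees-downward : ∀ i → (∀ {i′} → i′ < i → i′ ≤ 𝔪 → ∀ α → Agrees i′ α) → i ≤ 𝔪 →
              ∀ n → (∀ {n′} → n′ < n → ∀ α → suc 𝔪 ∸ α ≡ n′ → Agrees i α) →
              ∀ α → suc 𝔪 ∸ α ≡ n → Agrees i α
            agrees-downward i IHᵢ i≤𝔪 n IHₙ zero _ β p q (() , _) β∈ p∈ q∈
            agrees-downward i IHᵢ i≤𝔪 n IHₙ (suc a) n≡ β p q α∈ β∈ p∈ q∈
              with i <? 𝔪 | suc a ≤? 𝔪 ∸ i | β ≤? suc i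
            ... | yes i<𝔪 | yes α≤ | yes _ = FreeEntry.agrees i a β p q i<𝔪 α≤ β∈ p∈ q∈ earlier
              where
              earlier : ∀ i′ d t → i′ ≤ i → (i′ < i ⊎ suc a < d) → d ∈[ 1 ⋯ suc 𝔪 ] → t ∈[ 1 ⋯ k d ] →
                        X i′ d β t q ≈ Y i′ d β t q
              earlier i′ d t i′≤i earlier-entry d∈ t∈ with m≤n⇒m<n∨m≡n i′≤i | earlier-entry
              ... | inj₁ i′<i  | _          = IHᵢ i′<i (≤-trans i′≤i i≤𝔪) d β t q d∈ β∈ t∈ q∈
              ... | inj₂ P.refl | inj₁ i<i  = ⊥-elim (<-irrefl P.refl i<i)
              ... | inj₂ P.refl | inj₂ α<d =
                IHₙ (P.subst (suc 𝔪 ∸ d <_) n≡ (∸-monoʳ-< α<d (proj₂ d∈))) d P.refl β t q d∈ β∈ t∈ q∈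
            ... | no i≮𝔪 | _ | _ = X-fixed i (suc a) β p q i≤𝔪 α∈ β∈ p∈ q∈ (λ (i<𝔪 , _ , _) → i≮𝔪 i<𝔪)
            ... | yes _ | no α≰ | _ = X-fixed i (suc a) β p q i≤𝔪 α∈ β∈ p∈ q∈ (λ (_ , α≤ , _) → α≰ α≤)
            ... | yes _ | yes _ | no β≰ = X-fixed i (suc a) β p q i≤𝔪 α∈ β∈ p∈ q∈ (λ (_ , _ , β≤) → β≰ β≤)

            X≈C̄mat : ∀ i → i ≤ 𝔪 → ∀ α → Agrees i α
            X≈C̄mat = <-rec (λ i → i ≤ 𝔪 → ∀ α → Agrees i α) λ i IHᵢ i≤𝔪 α →
              <-rec (λ n → ∀ α → suc 𝔪 ∸ α ≡ n → Agrees i α) (agrees-downward i IHᵢ i≤𝔪) (suc 𝔪 ∸ α) α P.refl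

lemma3p33 : ∀ {c ℓ a ℓa : Level} (F : Field c ℓ) (V : Module (Field.commutativeRing F) a ℓa) →
  let open Setting F V
      open Exports
  in (N : Carrierᴹ → Carrierᴹ) → IsLinear N →
     (𝔪 : ℕ) → 1 ≤ 𝔪 → Nilpotent N 𝔪 →
     (k : ℕ → ℕ) (l : ℕ → ℕ → Carrierᴹ) →
     (∀ u0 → u0 < 𝔪 → IsBasisOfImage N 𝔪 k l u0) →
     (S P : MatFamily) → IsSFamily N 𝔪 k l S → IsPFamily N 𝔪 k l P →
     (X : ℕ → BlockMat) →
     (∀ i α β p q → i ≤ 𝔪 → α ∈[ 1 ⋯ suc 𝔪 ] → β ∈[ 1 ⋯ suc 𝔪 ] →
        p ∈[ 1 ⋯ k α ] → q ∈[ 1 ⋯ k (𝔪 + 2 ∸ β) ] →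
        ¬ FreeBlock 𝔪 i α β → X i α β p q ≈ C̄mat 𝔪 P i α β p q) →
     (∀ j α β p q → j < 𝔪 → α ∈[ 1 ⋯ suc 𝔪 ] → β ∈[ 1 ⋯ suc 𝔪 ] →
        p ∈[ 1 ⋯ k (𝔪 + 2 ∸ α) ] → q ∈[ 1 ⋯ k (𝔪 + 2 ∸ β) ] →
        prodCoeff 𝔪 k S X j α β p q ≈ 0#) →
     ∀ i α β p q → i ≤ 𝔪 → α ∈[ 1 ⋯ suc 𝔪 ] → β ∈[ 1 ⋯ suc 𝔪 ] →
        p ∈[ 1 ⋯ k α ] → q ∈[ 1 ⋯ k (𝔪 + 2 ∸ β) ] →
        X i α β p q ≈ C̄mat 𝔪 P i α β p q
lemma3p33 F V N N-linear 𝔪 1≤𝔪 nil k l basis S P isS isP X X-fixed X-annihilated i α β p q i≤𝔪 =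
  Uniqueness.X≈C̄mat F V N N-linear 𝔪 k l nil 1≤𝔪 basis S P isS isP X X-annihilated X-fixed i i≤𝔪 α β p q
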